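{- Let $k\ge2$. The weight enumerators $W_{\widetilde N_k}(x,y;q)$ and $W_{\widetilde Z_k}(x,y;q)$, regarded as quasi-polynomials in $q$, have the same minimum period $\rho_0=\mathrm{lcm}(1,2,\dots,k-1)$.
   Context: $\mathbb{Z}_q:=\mathbb{Z}/q\mathbb{Z}$. $I_k$ is the $k\times k$ identity, $J_k$ the $k\times k$ all-ones matrix, $1_k$ the all-ones column. $\widetilde N_k:=(I_k\mid J_k-I_k)$, $\widetilde Z_k:=(I_k\mid J_k-I_k\mid 1_k)$. For an integer matrix $G$ with $k$ rows and $n$ columns, $C_G(q):=\{uG\mid u\in\mathbb{Z}_q^k\}$ and $W_G(x,y;q):=\sum_{c\in C_G(q)}x^{n-\mathrm{wt}(c)}y^{\mathrm{wt}(c)}$, where $\mathrm{wt}(c)$ is the number of nonzero entries. A function $f:\mathbb{Z}_{>0}\to\mathbb{Z}[x,y]$ is a quasi-polynomial over $\mathbb{Q}[x,y]$ with period $\rho$ if there are polynomials $f^1,\dots,f^\rho\in\mathbb{Q}[x,y][t]$ with $f(q)=f^m(q)$ whenever $q\equiv m\pmod\rho$; the minimum period is the least such $\rho$. -}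

module Defs where

open import Data.Nat as ℕ using (ℕ; zero; suc; _≤_; _≟_)
open import Data.Nat.LCM using (lcm)
open import Data.Integer as ℤ using (ℤ; +_; _%ℕ_)
open import Data.Rational as ℚ using (ℚ; 0ℚ)
open import Data.Fin as Fin using (Fin; splitAt)
import Data.Fin.Properties as FinP
open import Data.List using (List; []; _∷_; map; foldr; filter; length; concatMap; allFin; upTo; deduplicate)
open import Data.List.Properties using (≡-dec)
open import Data.Sum using (inj₁; inj₂)
open import Data.Bool using (if_then_else_)
open import Relation.Nullary using (¬?; does)
open import Relation.Binary.PropositionalEquality using (_≡_)
open import Data.Product using (Σ; _×_)

Mat : ℕ → ℕ → Set
Mat k n = Fin k → Fin n → ℤ

Ntil : (k : ℕ) → Mat k (k ℕ.+ k)
Ntil k i j with splitAt k j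
... | inj₁ j' = if does (i Fin.≟ j') then + 1 else + 0
... | inj₂ j' = if does (i Fin.≟ j') then + 0 else + 1

Ztil : (k : ℕ) → Mat k ((k ℕ.+ k) ℕ.+ 1)
Ztil k i j with splitAt (k ℕ.+ k) j
... | inj₁ j' = Ntil k i j'
... | inj₂ _  = + 1

allVecs : (k q : ℕ) → List (Fin k → ℕ)
allVecs zero    q = (λ ()) ∷ []
allVecs (suc k) q =
  concatMap (λ a → map (λ v → λ { Fin.zero → a ; (Fin.suc i) → v i }) (allVecs k q)) (upTo q)

sumℤ : List ℤ → ℤ
sumℤ = foldr ℤ._+_ (+ 0)

-- The codeword uG ∈ ℤ_q^n (entries as residues in {0,…,q-1}), for q ≥ 1.
codeword : ∀ {k n} → Mat k n → (q : ℕ) → .{{_ : ℕ.NonZero q}} → (Fin k → ℕ) → List ℕ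
codeword {k} {n} G q u =
  map (λ j → sumℤ (map (λ i → + (u i) ℤ.* G i j) (allFin k)) %ℕ q) (allFin n)

code : ∀ {k n} → Mat k n → (q : ℕ) → .{{_ : ℕ.NonZero q}} → List (List ℕ)
code {k} G q = deduplicate (≡-dec _≟_) (map (codeword G q) (allVecs k q))

wt : List ℕ → ℕ
wt c = length (filter (λ a → ¬? (a ≟ 0)) c)

-- A polynomial in x, y with integer coefficients, given by its coefficient
-- function: (i , j) ↦ coefficient of x^i y^j.
Polyℤxy : Set
Polyℤxy = ℕ → ℕ → ℤ

-- W_G(x,y;q) = Σ_{c ∈ C_G(q)} x^{n - wt c} y^{wt c}, as coefficient function.
-- (Only q ≥ 1 is meaningful; the value at q = 0 is an unused dummy.)
W : ∀ {k n} → Mat k n → ℕ → Polyℤxy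
W G zero    i j = + 0
W {k} {n} G q@(suc _) i j =
  if does ((i ℕ.+ j) ≟ n)
  then + length (filter (λ c → wt c ≟ j) (code G q))
  else + 0

-- A polynomial in Q[x,y][t], given by coefficients: (i , j) ↦ the
-- polynomial in t (list of rational coefficients, constant term first)
-- multiplying x^i y^j.
PolyℚxyT : Set
PolyℚxyT = ℕ → ℕ → List ℚ

evalT : List ℚ → ℚ → ℚ
evalT cs t = foldr (λ a acc → a ℚ.+ t ℚ.* acc) 0ℚ cs

toℚ : ℤ → ℚ
toℚ z = z ℚ./ 1

-- f is a quasi-polynomial over Q[x,y] with period ρ (ρ ≥ 1): there are
-- f^1,…,f^ρ ∈ Q[x,y][t] with f(q) = f^m(q) whenever q ≡ m (mod ρ), q ≥ 1.
-- Every q ≥ 1 is uniquely q = m + t·ρ with 1 ≤ m ≤ ρ.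
IsQuasiPolyWithPeriod : (ℕ → Polyℤxy) → ℕ → Set
IsQuasiPolyWithPeriod F ρ =
  1 ≤ ρ ×
  Σ (ℕ → PolyℚxyT) λ f →
    ∀ (m t : ℕ) → 1 ≤ m → m ≤ ρ → ∀ (i j : ℕ) →
      evalT (f m i j) (toℚ (+ (m ℕ.+ t ℕ.* ρ))) ≡ toℚ (F (m ℕ.+ t ℕ.* ρ) i j)

IsMinimumPeriod : (ℕ → Polyℤxy) → ℕ → Set
IsMinimumPeriod F ρ =
  IsQuasiPolyWithPeriod F ρ × (∀ ρ' → IsQuasiPolyWithPeriod F ρ' → ρ ≤ ρ')

lcmUpTo : ℕ → ℕ
lcmUpTo zero    = 1
lcmUpTo (suc m) = lcm (suc m) (lcmUpTo m)

-- With s = Σ u mod q, the codeword uÑ_k has the entries u_i and s - u_i, so its weight is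
-- Σ_i ([u_i ≠ 0] + [u_i ≠ s]) (plus [s ≠ 0] for Z̃_k), and distinct u give distinct codewords.
-- Splitting off one coordinate of u shows that, for 0 < s < q, the number of u with Σ u ≡ t and
-- this weight equal to w is β_k(q, w) + Σ_{i ≤ k} α_k(i, w) [t ≡ i s], with β_k polynomial in q
-- and α_k independent of q. Taking t = s and summing over s, every coefficient of W becomes a
-- polynomial in q plus Σ_i α_k(i, w) (gcd(i - 1, q) - 1), because i s ≡ s (mod q) has gcd(i - 1, q)
-- solutions s. These gcds have period lcm(1, …, k - 1).
-- Conversely, at weight w = k the coefficients α_k(i, k) = C(k, i) are positive. If ρ′ is a
-- period, the polynomial attached to the multiples of ρ′ forces the gcd part to take the
-- same value at ρ′ as at ρ₀ = lcm(1, …, k - 1), where it is maximal; so every d ≤ k - 1 divides ρ′.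

module Submission where

open import Defs
open import Data.Nat using (ℕ; _≤_; _∸_)
open import Data.Product using (_×_)
open import Data.Nat using (zero; suc; s≤s; NonZero)
open import Data.Product using (_,_)

module RationalPolynomial where

  open import Defs using (evalT)
  open import Data.Nat as ℕ using (ℕ; suc; _≤_; s≤s)
  import Data.Nat.Properties as ℕP
  open import Data.Rational as ℚ using (ℚ; 0ℚ; 1ℚ; _+_; _*_; -_; _-_)
  import Data.Rational.Properties as ℚP
  open import Data.Rational.Solver using (module +-*-Solver)
  open import Data.List using (List; []; _∷_; length)
  open import Data.Sum using (_⊎_; inj₁; inj₂)
  open import Function.Definitions using (Injective)
  open import Relation.Binary.PropositionalEquality
  open import Relation.Nullary using (yes; no)
  open import Data.Empty using (⊥-elim)
  open +-*-Solver
  open ≡-Reasoning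

  Poly : Set
  Poly = List ℚ

  infixl 6 _+ₚ_
  infixl 7 _*ₚ_ _·ₚ_

  _+ₚ_ : Poly → Poly → Poly
  []      +ₚ q       = q
  (a ∷ p) +ₚ []      = a ∷ p
  (a ∷ p) +ₚ (b ∷ q) = (a + b) ∷ (p +ₚ q)

  _·ₚ_ : ℚ → Poly → Poly
  c ·ₚ []      = []
  c ·ₚ (a ∷ p) = c * a ∷ c ·ₚ p

  _*ₚ_ : Poly → Poly → Poly
  []      *ₚ q = []
  (a ∷ p) *ₚ q = a ·ₚ q +ₚ (0ℚ ∷ p *ₚ q)

  -ₚ_ : Poly → Poly
  -ₚ_ = - 1ℚ ·ₚ_

  constₚ : ℚ → Poly
  constₚ c = c ∷ []

  varₚ : Poly
  varₚ = 0ℚ ∷ 1ℚ ∷ []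

  evalT-+ₚ : ∀ p q x → evalT (p +ₚ q) x ≡ evalT p x + evalT q x
  evalT-+ₚ []      q       x = sym (ℚP.+-identityˡ _)
  evalT-+ₚ (a ∷ p) []      x = sym (ℚP.+-identityʳ _)
  evalT-+ₚ (a ∷ p) (b ∷ q) x = begin
    (a + b) + x * evalT (p +ₚ q) x
      ≡⟨ cong (λ z → (a + b) + x * z) (evalT-+ₚ p q x) ⟩
    (a + b) + x * (evalT p x + evalT q x)
      ≡⟨ solve 5 (λ a b x u v → (a :+ b) :+ x :* (u :+ v) := (a :+ x :* u) :+ (b :+ x :* v))
         refl a b x (evalT p x) (evalT q x) ⟩
    (a + x * evalT p x) + (b + x * evalT q x) ∎

  evalT-·ₚ : ∀ c p x → evalT (c ·ₚ p) x ≡ c * evalT p x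
  evalT-·ₚ c []      x = sym (ℚP.*-zeroʳ c)
  evalT-·ₚ c (a ∷ p) x = begin
    c * a + x * evalT (c ·ₚ p) x
      ≡⟨ cong (λ z → c * a + x * z) (evalT-·ₚ c p x) ⟩
    c * a + x * (c * evalT p x)
      ≡⟨ solve 4 (λ c a x u → c :* a :+ x :* (c :* u) := c :* (a :+ x :* u)) refl c a x (evalT p x) ⟩
    c * (a + x * evalT p x) ∎

  evalT-*ₚ : ∀ p q x → evalT (p *ₚ q) x ≡ evalT p x * evalT q x
  evalT-*ₚ []      q x = sym (ℚP.*-zeroˡ (evalT q x))
  evalT-*ₚ (a ∷ p) q x = begin
    evalT (a ·ₚ q +ₚ (0ℚ ∷ p *ₚ q)) x
      ≡⟨ evalT-+ₚ (a ·ₚ q) (0ℚ ∷ p *ₚ q) x ⟩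
    evalT (a ·ₚ q) x + (0ℚ + x * evalT (p *ₚ q) x)
      ≡⟨ cong₂ (λ u v → u + (0ℚ + x * v)) (evalT-·ₚ a q x) (evalT-*ₚ p q x) ⟩
    a * Q + (0ℚ + x * (evalT p x * Q))
      ≡⟨ solve 4 (λ a x u v → a :* v :+ (con 0ℚ :+ x :* (u :* v)) := (a :+ x :* u) :* v)
         refl a x (evalT p x) Q ⟩
    (a + x * evalT p x) * Q ∎
    where Q = evalT q x

  evalT--ₚ : ∀ p x → evalT (-ₚ p) x ≡ - evalT p x
  evalT--ₚ p x = trans (evalT-·ₚ (- 1ℚ) p x) (solve 1 (λ u → :- con 1ℚ :* u := :- u) refl (evalT p x))

  evalT-constₚ : ∀ c x → evalT (constₚ c) x ≡ c
  evalT-constₚ c x = solve 2 (λ c x → c :+ x :* con 0ℚ := c) refl c x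

  evalT-varₚ : ∀ x → evalT varₚ x ≡ x
  evalT-varₚ x = solve 1 (λ x → con 0ℚ :+ x :* (con 1ℚ :+ x :* con 0ℚ) := x) refl x

  -- Division by t - r: the coefficients of the quotient are the partial Horner values at r.
  quotient : Poly → ℚ → Poly
  quotient []          r = []
  quotient (a ∷ [])    r = []
  quotient (a ∷ b ∷ p) r = evalT (b ∷ p) r ∷ quotient (b ∷ p) r

  evalT-quotient : ∀ p r x → evalT p x ≡ evalT p r + (x - r) * evalT (quotient p r) x
  evalT-quotient []          r x = solve 2 (λ x r → con 0ℚ := con 0ℚ :+ (x :- r) :* con 0ℚ) refl x r
  evalT-quotient (a ∷ [])    r x =
    solve 3 (λ a x r → a :+ x :* con 0ℚ := (a :+ r :* con 0ℚ) :+ (x :- r) :* con 0ℚ) refl a x r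
  evalT-quotient (a ∷ b ∷ p) r x = begin
    a + x * evalT (b ∷ p) x
      ≡⟨ cong (λ z → a + x * z) (evalT-quotient (b ∷ p) r x) ⟩
    a + x * (P + (x - r) * Q)
      ≡⟨ solve 5 (λ a x r P Q → a :+ x :* (P :+ (x :- r) :* Q) := (a :+ r :* P) :+ (x :- r) :* (P :+ x :* Q))
         refl a x r P Q ⟩
    (a + r * P) + (x - r) * (P + x * Q) ∎
    where
    P = evalT (b ∷ p) r
    Q = evalT (quotient (b ∷ p) r) x

  length-quotient : ∀ p r → length (quotient p r) ≡ ℕ.pred (length p)
  length-quotient []          r = refl
  length-quotient (a ∷ [])    r = refl
  length-quotient (a ∷ b ∷ p) r = cong suc (length-quotient (b ∷ p) r)

  p-q≡0⇒p≡q : ∀ p q → p - q ≡ 0ℚ → p ≡ q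
  p-q≡0⇒p≡q p q p-q≡0 = begin
    p             ≡⟨ solve 2 (λ p q → p := (p :- q) :+ q) refl p q ⟩
    (p - q) + q   ≡⟨ cong (_+ q) p-q≡0 ⟩
    0ℚ + q        ≡⟨ ℚP.+-identityˡ q ⟩
    q             ∎

  p*q≡0⇒p≡0∨q≡0 : ∀ p q → p * q ≡ 0ℚ → p ≡ 0ℚ ⊎ q ≡ 0ℚ
  p*q≡0⇒p≡0∨q≡0 p q pq≡0 with p ℚP.≟ 0ℚ
  ... | yes p≡0 = inj₁ p≡0
  ... | no  p≢0 = inj₂ (begin
    q               ≡⟨ sym (ℚP.*-identityˡ q) ⟩
    1ℚ * q          ≡⟨ cong (_* q) (sym (ℚP.*-inverseˡ p {{ℚ.≢-nonZero p≢0}})) ⟩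
    (p⁻¹ * p) * q   ≡⟨ ℚP.*-assoc p⁻¹ p q ⟩
    p⁻¹ * (p * q)   ≡⟨ cong (p⁻¹ *_) pq≡0 ⟩
    p⁻¹ * 0ℚ        ≡⟨ ℚP.*-zeroʳ p⁻¹ ⟩
    0ℚ              ∎)
    where p⁻¹ = (ℚ.1/ p) {{ℚ.≢-nonZero p≢0}}

  -- n bounds the length of p and is the induction measure: quotient is not structurally smaller.
  vanishing-on-injective⇒zero : ∀ n p → length p ≤ n → (e : ℕ → ℚ) → Injective _≡_ _≡_ e →
                               (∀ i → evalT p (e i) ≡ 0ℚ) → ∀ x → evalT p x ≡ 0ℚ
  vanishing-on-injective⇒zero n       []      _         e e-inj roots x = refl
  vanishing-on-injective⇒zero (suc n) (a ∷ p) (s≤s |p|≤n) e e-inj roots x = begin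
    evalT (a ∷ p) x                   ≡⟨ evalT-quotient (a ∷ p) r x ⟩
    evalT (a ∷ p) r + (x - r) * Q x   ≡⟨ cong₂ (λ u v → u + (x - r) * v) (roots 0) (Q≡0 x) ⟩
    0ℚ + (x - r) * 0ℚ                 ≡⟨ solve 2 (λ x r → con 0ℚ :+ (x :- r) :* con 0ℚ := con 0ℚ) refl x r ⟩
    0ℚ                                ∎
    where
    r = e 0
    Q = evalT (quotient (a ∷ p) r)
    factor≡0 : ∀ i → (e (suc i) - r) * Q (e (suc i)) ≡ 0ℚ
    factor≡0 i = begin
      (y - r) * Q y                     ≡⟨ ℚP.+-identityˡ _ ⟨
      0ℚ + (y - r) * Q y                ≡⟨ cong (_+ (y - r) * Q y) (roots 0) ⟨
      evalT (a ∷ p) r + (y - r) * Q y   ≡⟨ evalT-quotient (a ∷ p) r y ⟨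
      evalT (a ∷ p) y                   ≡⟨ roots (suc i) ⟩
      0ℚ                                ∎
      where y = e (suc i)
    Q-roots : ∀ i → Q (e (suc i)) ≡ 0ℚ
    Q-roots i with p*q≡0⇒p≡0∨q≡0 _ _ (factor≡0 i)
    ... | inj₁ eᵢ-r≡0 = ⊥-elim (ℕP.1+n≢0 (e-inj (p-q≡0⇒p≡q _ _ eᵢ-r≡0)))
    ... | inj₂ Qᵢ≡0   = Qᵢ≡0
    Q≡0 : ∀ x → Q x ≡ 0ℚ
    Q≡0 = vanishing-on-injective⇒zero n (quotient (a ∷ p) r)
            (subst (_≤ n) (sym (length-quotient (a ∷ p) r)) |p|≤n)
            (λ i → e (suc i)) (λ eq → ℕP.suc-injective (e-inj eq)) Q-roots

module ToℚHomomorphism where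

  open import Defs using (toℚ)
  open import Data.Integer as ℤ using (ℤ)
  import Data.Integer.Properties as ℤP
  open import Data.Rational as ℚ using (_+_; _*_; -_)
  import Data.Rational.Properties as ℚP
  open import Data.Rational.Unnormalised as ℚᵘ using (ℚᵘ; mkℚᵘ; _≃_; *≡*)
  import Data.Rational.Unnormalised.Properties as ℚᵘP
  open import Relation.Binary.PropositionalEquality
  open ℚᵘP.≃-Reasoning

  private
    _/1ᵘ : ℤ → ℚᵘ
    z /1ᵘ = mkℚᵘ z 0

    toℚᵘ-toℚ : ∀ z → ℚ.toℚᵘ (toℚ z) ≃ z /1ᵘ
    toℚᵘ-toℚ z = ℚP.toℚᵘ-fromℚᵘ (z /1ᵘ)

    /1ᵘ-+ : ∀ a b → a /1ᵘ ℚᵘ.+ b /1ᵘ ≃ (a ℤ.+ b) /1ᵘ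
    /1ᵘ-+ a b = *≡* (cong (ℤ._* ℤ.+ 1) (cong₂ ℤ._+_ (ℤP.*-identityʳ a) (ℤP.*-identityʳ b)))

  toℚ-+ : ∀ a b → toℚ (a ℤ.+ b) ≡ toℚ a + toℚ b
  toℚ-+ a b = ℚP.toℚᵘ-injective (begin
    ℚ.toℚᵘ (toℚ (a ℤ.+ b))               ≈⟨ toℚᵘ-toℚ (a ℤ.+ b) ⟩
    (a ℤ.+ b) /1ᵘ                         ≈⟨ /1ᵘ-+ a b ⟨
    a /1ᵘ ℚᵘ.+ b /1ᵘ                      ≈⟨ ℚᵘP.+-cong (toℚᵘ-toℚ a) (toℚᵘ-toℚ b) ⟨
    ℚ.toℚᵘ (toℚ a) ℚᵘ.+ ℚ.toℚᵘ (toℚ b)   ≈⟨ ℚP.toℚᵘ-homo-+ (toℚ a) (toℚ b) ⟨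
    ℚ.toℚᵘ (toℚ a + toℚ b)               ∎)

  toℚ-* : ∀ a b → toℚ (a ℤ.* b) ≡ toℚ a * toℚ b
  toℚ-* a b = ℚP.toℚᵘ-injective (begin
    ℚ.toℚᵘ (toℚ (a ℤ.* b))               ≈⟨ toℚᵘ-toℚ (a ℤ.* b) ⟩
    (a ℤ.* b) /1ᵘ                         ≈⟨ *≡* refl ⟩
    a /1ᵘ ℚᵘ.* b /1ᵘ                      ≈⟨ ℚᵘP.*-cong (toℚᵘ-toℚ a) (toℚᵘ-toℚ b) ⟨
    ℚ.toℚᵘ (toℚ a) ℚᵘ.* ℚ.toℚᵘ (toℚ b)   ≈⟨ ℚP.toℚᵘ-homo-* (toℚ a) (toℚ b) ⟨
    ℚ.toℚᵘ (toℚ a * toℚ b)               ∎)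

  toℚ-neg : ∀ a → toℚ (ℤ.- a) ≡ - toℚ a
  toℚ-neg a = ℚP.toℚᵘ-injective (begin
    ℚ.toℚᵘ (toℚ (ℤ.- a))    ≈⟨ toℚᵘ-toℚ (ℤ.- a) ⟩
    (ℤ.- a) /1ᵘ              ≈⟨ *≡* refl ⟩
    ℚᵘ.- (a /1ᵘ)             ≈⟨ ℚᵘP.-‿cong (toℚᵘ-toℚ a) ⟨
    ℚᵘ.- ℚ.toℚᵘ (toℚ a)      ≈⟨ ℚP.toℚᵘ-homo‿- (toℚ a) ⟨
    ℚ.toℚᵘ (- toℚ a)         ∎)

  toℚ-injective : ∀ {a b} → toℚ a ≡ toℚ b → a ≡ b
  toℚ-injective {a} {b} eq with begin
    a /1ᵘ                  ≈⟨ toℚᵘ-toℚ a ⟨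
    ℚ.toℚᵘ (toℚ a)        ≈⟨ ℚP.toℚᵘ-cong eq ⟩
    ℚ.toℚᵘ (toℚ b)        ≈⟨ toℚᵘ-toℚ b ⟩
    b /1ᵘ                  ∎
  ... | *≡* a*1≡b*1 = trans (sym (ℤP.*-identityʳ a)) (trans a*1≡b*1 (ℤP.*-identityʳ b))

module FiniteSum where

  open import Data.Nat as ℕ using (ℕ; zero; suc; _<_; z≤n; s≤s)
  open import Data.Integer as ℤ using (ℤ; +_; _+_; _*_; -_; _-_)
  import Data.Integer.Properties as ℤP
  import Data.Nat.Properties as ℕP
  open import Data.Integer.Solver using (module +-*-Solver)
  open import Data.Bool using (if_then_else_)
  open import Relation.Binary.PropositionalEquality
  open import Relation.Nullary using (¬_; Dec; does; yes; no)
  open import Data.Empty using (⊥-elim)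
  open import Relation.Nullary.Decidable using (dec-true; dec-false; does-⇔)
  open import Function.Bundles using (mk⇔)
  open +-*-Solver
  open ≡-Reasoning

  -- Opaque: unfolded, 𝟙 (a ≟ b) becomes a test on a ≡ᵇ b, from which neither `with a ≟ b`
  -- nor unification can recover the decision procedure.
  opaque
    𝟙 : {P : Set} → Dec P → ℤ
    𝟙 P? = if does P? then + 1 else + 0

    𝟙-yes : {P : Set} (P? : Dec P) → P → 𝟙 P? ≡ + 1
    𝟙-yes P? p = cong (if_then + 1 else + 0) (dec-true P? p)

    𝟙-no : {P : Set} (P? : Dec P) → ¬ P → 𝟙 P? ≡ + 0
    𝟙-no P? ¬p = cong (if_then + 1 else + 0) (dec-false P? ¬p)

    𝟙-cong : {P Q : Set} {P? : Dec P} {Q? : Dec Q} → (P → Q) → (Q → P) → 𝟙 P? ≡ 𝟙 Q?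
    𝟙-cong {P? = P?} {Q?} P→Q Q→P = cong (if_then + 1 else + 0) (does-⇔ (mk⇔ P→Q Q→P) P? Q?)

  𝟙-sym : ∀ a b → 𝟙 (a ℕ.≟ b) ≡ 𝟙 (b ℕ.≟ a)
  𝟙-sym a b = 𝟙-cong sym sym

  ∑ : ℕ → (ℕ → ℤ) → ℤ
  ∑ zero    f = + 0
  ∑ (suc n) f = f 0 + ∑ n (λ i → f (suc i))

  syntax ∑ n (λ i → e) = ∑[ i < n ] e

  ∑-cong : ∀ n {f g} → (∀ i → i < n → f i ≡ g i) → ∑ n f ≡ ∑ n g
  ∑-cong zero    f≡g = refl
  ∑-cong (suc n) f≡g = cong₂ _+_ (f≡g 0 (s≤s z≤n)) (∑-cong n (λ i i<n → f≡g (suc i) (s≤s i<n)))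

  ∑-cong′ : ∀ n {f g} → (∀ i → f i ≡ g i) → ∑ n f ≡ ∑ n g
  ∑-cong′ n f≡g = ∑-cong n (λ i _ → f≡g i)

  ∑-zero : ∀ n {f} → (∀ i → i < n → f i ≡ + 0) → ∑ n f ≡ + 0
  ∑-zero zero    f≡0 = refl
  ∑-zero (suc n) f≡0 = cong₂ _+_ (f≡0 0 (s≤s z≤n)) (∑-zero n (λ i i<n → f≡0 (suc i) (s≤s i<n)))

  ∑-const : ∀ n c → ∑[ _ < n ] c ≡ + n * c
  ∑-const zero    c = sym (ℤP.*-zeroˡ c)
  ∑-const (suc n) c =
    trans (cong (_+_ c) (∑-const n c)) (solve 2 (λ c n → c :+ n :* c := (con (+ 1) :+ n) :* c) refl c (+ n))

  ∑-+ : ∀ n f g → ∑[ i < n ] (f i + g i) ≡ ∑ n f + ∑ n g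
  ∑-+ zero    f g = refl
  ∑-+ (suc n) f g = trans (cong (_+_ (f 0 + g 0)) (∑-+ n (λ i → f (suc i)) (λ i → g (suc i))))
    (solve 4 (λ a b c d → (a :+ b) :+ (c :+ d) := (a :+ c) :+ (b :+ d)) refl (f 0) (g 0) _ _)

  ∑-*ˡ : ∀ n c f → ∑[ i < n ] (c * f i) ≡ c * ∑ n f
  ∑-*ˡ zero    c f = sym (ℤP.*-zeroʳ c)
  ∑-*ˡ (suc n) c f = trans (cong (_+_ (c * f 0)) (∑-*ˡ n c (λ i → f (suc i)))) (sym (ℤP.*-distribˡ-+ c (f 0) _))

  ∑--ʳ : ∀ n f g → ∑[ i < n ] (f i - g i) ≡ ∑ n f - ∑ n g
  ∑--ʳ n f g = begin
    ∑[ i < n ] (f i - g i)                ≡⟨ ∑-+ n f (λ i → - g i) ⟩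
    ∑ n f + ∑[ i < n ] (- g i)            ≡⟨ cong (_+_ (∑ n f)) (∑-cong′ n (λ i → sym (ℤP.-1*i≡-i (g i)))) ⟩
    ∑ n f + ∑[ i < n ] (ℤ.-1ℤ * g i)      ≡⟨ cong (_+_ (∑ n f)) (trans (∑-*ˡ n ℤ.-1ℤ g) (ℤP.-1*i≡-i _)) ⟩
    ∑ n f - ∑ n g                         ∎

  ∑-split : ∀ m n f → ∑ (m ℕ.+ n) f ≡ ∑ m f + ∑[ i < n ] f (m ℕ.+ i)
  ∑-split zero    n f = sym (ℤP.+-identityˡ _)
  ∑-split (suc m) n f = trans (cong (_+_ (f 0)) (∑-split m n (λ i → f (suc i)))) (sym (ℤP.+-assoc (f 0) _ _))

  ∑-swap : ∀ m n (f : ℕ → ℕ → ℤ) → ∑[ i < m ] ∑[ j < n ] f i j ≡ ∑[ j < n ] ∑[ i < m ] f i j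
  ∑-swap zero    n f = sym (∑-zero n (λ _ _ → refl))
  ∑-swap (suc m) n f = begin
    ∑[ j < n ] f 0 j + ∑[ i < m ] ∑[ j < n ] f (suc i) j
      ≡⟨ cong (_+_ (∑[ j < n ] f 0 j)) (∑-swap m n (λ i → f (suc i))) ⟩
    ∑[ j < n ] f 0 j + ∑[ j < n ] ∑[ i < m ] f (suc i) j
      ≡⟨ ∑-+ n (λ j → f 0 j) (λ j → ∑[ i < m ] f (suc i) j) ⟨
    ∑[ j < n ] (f 0 j + ∑[ i < m ] f (suc i) j) ∎

  ∑-𝟙* : ∀ n b f → b < n → ∑[ i < n ] (𝟙 (i ℕ.≟ b) * f i) ≡ f b
  ∑-𝟙* (suc n) zero f _ = begin
    𝟙 (0 ℕ.≟ 0) * f 0 + ∑[ i < n ] (𝟙 (suc i ℕ.≟ 0) * f (suc i))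
      ≡⟨ cong₂ _+_ (cong (_* f 0) (𝟙-yes (0 ℕ.≟ 0) refl))
                   (∑-zero n (λ i _ → cong (_* f (suc i)) (𝟙-no (suc i ℕ.≟ 0) λ ()))) ⟩
    + 1 * f 0 + + 0
      ≡⟨ trans (ℤP.+-identityʳ _) (ℤP.*-identityˡ (f 0)) ⟩
    f 0 ∎
  ∑-𝟙* (suc n) (suc b) f (s≤s b<n) = begin
    𝟙 (0 ℕ.≟ suc b) * f 0 + ∑[ i < n ] (𝟙 (suc i ℕ.≟ suc b) * f (suc i))
      ≡⟨ cong₂ _+_ (cong (_* f 0) (𝟙-no (0 ℕ.≟ suc b) λ ()))
                   (∑-cong′ n (λ i → cong (_* f (suc i)) (𝟙-cong ℕP.suc-injective (cong suc)))) ⟩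
    + 0 * f 0 + ∑[ i < n ] (𝟙 (i ℕ.≟ b) * f (suc i))
      ≡⟨ cong (_+_ (+ 0 * f 0)) (∑-𝟙* n b (λ i → f (suc i)) b<n) ⟩
    + 0 + f (suc b)
      ≡⟨ ℤP.+-identityˡ (f (suc b)) ⟩
    f (suc b) ∎

  ∑-𝟙 : ∀ n b → b < n → ∑[ i < n ] 𝟙 (i ℕ.≟ b) ≡ + 1
  ∑-𝟙 n b b<n = trans (∑-cong′ n (λ i → sym (ℤP.*-identityʳ _))) (∑-𝟙* n b (λ _ → + 1) b<n)

  ∑-involution : ∀ n (σ : ℕ → ℕ) → (∀ i → i < n → σ i < n) → (∀ i → i < n → σ (σ i) ≡ i) →
                 ∀ f → ∑[ i < n ] f (σ i) ≡ ∑ n f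
  ∑-involution n σ σ<n σσ≡id f = begin
    ∑[ i < n ] f (σ i)
      ≡⟨ ∑-cong n (λ i i<n → sym (∑-𝟙* n (σ i) f (σ<n i i<n))) ⟩
    ∑[ i < n ] ∑[ j < n ] (𝟙 (j ℕ.≟ σ i) * f j)
      ≡⟨ ∑-swap n n (λ i j → 𝟙 (j ℕ.≟ σ i) * f j) ⟩
    ∑[ j < n ] ∑[ i < n ] (𝟙 (j ℕ.≟ σ i) * f j)
      ≡⟨ ∑-cong n (λ j j<n → ∑-cong n (λ i i<n → cong (_* f j) (j≡σi⇔i≡σj i j i<n j<n))) ⟩
    ∑[ j < n ] ∑[ i < n ] (𝟙 (i ℕ.≟ σ j) * f j)
      ≡⟨ ∑-cong n (λ j j<n → trans (∑-cong′ n (λ i → ℤP.*-comm _ (f j))) (∑-*ˡ n (f j) _)) ⟩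
    ∑[ j < n ] (f j * ∑[ i < n ] 𝟙 (i ℕ.≟ σ j))
      ≡⟨ ∑-cong n (λ j j<n → trans (cong (f j *_) (∑-𝟙 n (σ j) (σ<n j j<n))) (ℤP.*-identityʳ (f j))) ⟩
    ∑ n f ∎
    where
    j≡σi⇔i≡σj : ∀ i j → i < n → j < n → 𝟙 (j ℕ.≟ σ i) ≡ 𝟙 (i ℕ.≟ σ j)
    j≡σi⇔i≡σj i j i<n j<n = 𝟙-cong (λ j≡σi → trans (sym (σσ≡id i i<n)) (cong σ (sym j≡σi)))
                                    (λ i≡σj → trans (sym (σσ≡id j j<n)) (cong σ (sym i≡σj)))

  ∑-update : ∀ n b c g → b < n → ∑[ a < n ] (g a + 𝟙 (a ℕ.≟ b) * c) ≡ ∑ n g + c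
  ∑-update n b c g b<n = trans (∑-+ n g _) (cong (_+_ (∑ n g)) (∑-𝟙* n b (λ _ → c) b<n))

  private
    ≡+𝟙*Δ : ∀ (f g : ℕ → ℤ) b a → (a ≢ b → f a ≡ g a) → f a ≡ g a + 𝟙 (a ℕ.≟ b) * (f b - g b)
    ≡+𝟙*Δ f g b a f≡g with a ℕ.≟ b
    ... | yes refl = trans (solve 2 (λ f g → f := g :+ con (+ 1) :* (f :- g)) refl (f a) (g a))
                            (cong (λ z → g a + z * (f a - g a)) (sym (𝟙-yes _ refl)))
    ... | no  a≢b  = trans (trans (f≡g a≢b) (solve 2 (λ g c → g := g :+ con (+ 0) :* c) refl (g a) (f b - g b)))
                            (cong (λ z → g a + z * (f b - g b)) (sym (𝟙-no _ a≢b)))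

  ∑-differ-at₁ : ∀ n f g b → b < n → (∀ a → a ≢ b → f a ≡ g a) → ∑ n f ≡ ∑ n g + (f b - g b)
  ∑-differ-at₁ n f g b b<n f≡g =
    trans (∑-cong′ n (λ a → ≡+𝟙*Δ f g b a (f≡g a))) (∑-update n b (f b - g b) g b<n)

  ∑-differ-at₂ : ∀ n f g b₁ b₂ → b₁ < n → b₂ < n → b₁ ≢ b₂ →
                 (∀ a → a ≢ b₁ → a ≢ b₂ → f a ≡ g a) → ∑ n f ≡ ∑ n g + (f b₁ - g b₁) + (f b₂ - g b₂)
  ∑-differ-at₂ n f g b₁ b₂ b₁<n b₂<n b₁≢b₂ f≡g = begin
    ∑ n f
      ≡⟨ ∑-differ-at₁ n f h b₂ b₂<n (λ a a≢b₂ → ≡+𝟙*Δ f g b₁ a (λ a≢b₁ → f≡g a a≢b₁ a≢b₂)) ⟩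
    ∑ n h + (f b₂ - h b₂)
      ≡⟨ cong₂ (λ x y → x + (f b₂ - y)) (∑-update n b₁ (f b₁ - g b₁) g b₁<n) h≡g ⟩
    ∑ n g + (f b₁ - g b₁) + (f b₂ - g b₂) ∎
    where
    h = λ a → g a + 𝟙 (a ℕ.≟ b₁) * (f b₁ - g b₁)
    h≡g : h b₂ ≡ g b₂
    h≡g = trans (cong (λ z → g b₂ + z * (f b₁ - g b₁)) (𝟙-no (b₂ ℕ.≟ b₁) (λ e → b₁≢b₂ (sym e))))
                (solve 2 (λ g c → g :+ con (+ 0) :* c := g) refl (g b₂) (f b₁ - g b₁))

  ∑-[a-b]*[x+y] : ∀ n (a b x y : ℕ → ℤ) →
                  ∑[ i < n ] ((a i - b i) * (x i + y i)) ≡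
                  (∑[ i < n ] (a i * x i) - ∑[ i < n ] (b i * x i)) + (∑[ i < n ] (a i * y i) - ∑[ i < n ] (b i * y i))
  ∑-[a-b]*[x+y] n a b x y = begin
    ∑[ i < n ] ((a i - b i) * (x i + y i))
      ≡⟨ ∑-cong′ n (λ i → solve 4 (λ a b x y → (a :- b) :* (x :+ y) := (a :* x :- b :* x) :+ (a :* y :- b :* y))
         refl (a i) (b i) (x i) (y i)) ⟩
    ∑[ i < n ] ((a i * x i - b i * x i) + (a i * y i - b i * y i))
      ≡⟨ ∑-+ n (λ i → a i * x i - b i * x i) (λ i → a i * y i - b i * y i) ⟩
    ∑[ i < n ] (a i * x i - b i * x i) + ∑[ i < n ] (a i * y i - b i * y i)
      ≡⟨ cong₂ _+_ (∑--ʳ n (λ i → a i * x i) (λ i → b i * x i)) (∑--ʳ n (λ i → a i * y i) (λ i → b i * y i)) ⟩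
    (∑[ i < n ] (a i * x i) - ∑[ i < n ] (b i * x i)) + (∑[ i < n ] (a i * y i) - ∑[ i < n ] (b i * y i)) ∎

  ∑-mono-≤ : ∀ n {f g} → (∀ i → i < n → f i ℤ.≤ g i) → ∑ n f ℤ.≤ ∑ n g
  ∑-mono-≤ zero    f≤g = ℤP.≤-refl
  ∑-mono-≤ (suc n) f≤g = ℤP.+-mono-≤ (f≤g 0 (s≤s z≤n)) (∑-mono-≤ n (λ i i<n → f≤g (suc i) (s≤s i<n)))

  private
    -a+[a+x]≡x : ∀ a x → - a + (a + x) ≡ x
    -a+[a+x]≡x a x = solve 2 (λ a x → :- a :+ (a :+ x) := x) refl a x

  ∑-≤-≡⇒≡ : ∀ n {f g} → (∀ i → i < n → f i ℤ.≤ g i) → ∑ n f ≡ ∑ n g → ∀ i → i < n → f i ≡ g i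
  ∑-≤-≡⇒≡ (suc n) {f} {g} f≤g ∑f≡∑g i i<n with f 0 ℤ.≟ g 0
  ... | no f₀≢g₀ = ⊥-elim (ℤP.<⇒≢ ∑f<∑g ∑f≡∑g)
    where
    ∑f<∑g = ℤP.+-mono-<-≤ (ℤP.≤∧≢⇒< (f≤g 0 (s≤s z≤n)) f₀≢g₀)
                          (∑-mono-≤ n (λ i i<n → f≤g (suc i) (s≤s i<n)))
  ... | yes f₀≡g₀ = rest i i<n
    where
    f′ = λ i → f (suc i)
    g′ = λ i → g (suc i)
    ∑f′≡∑g′ : ∑ n f′ ≡ ∑ n g′
    ∑f′≡∑g′ = begin
      ∑ n f′                     ≡⟨ -a+[a+x]≡x (g 0) (∑ n f′) ⟨
      - g 0 + (g 0 + ∑ n f′)     ≡⟨ cong (λ x → - g 0 + (x + ∑ n f′)) f₀≡g₀ ⟨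
      - g 0 + (f 0 + ∑ n f′)     ≡⟨ cong (_+_ (- g 0)) ∑f≡∑g ⟩
      - g 0 + (g 0 + ∑ n g′)     ≡⟨ -a+[a+x]≡x (g 0) (∑ n g′) ⟩
      ∑ n g′                     ∎
    rest : ∀ i → i < suc n → f i ≡ g i
    rest zero    _         = f₀≡g₀
    rest (suc i) (s≤s i<n) = ∑-≤-≡⇒≡ n (λ i i<n → f≤g (suc i) (s≤s i<n)) ∑f′≡∑g′ i i<n

module Residue (q : ℕ) .{{_ : NonZero q}} where

  open import Data.Nat
  open import Data.Nat.Properties
  open import Data.Nat.DivMod
  open import Relation.Binary.PropositionalEquality
  open ≡-Reasoning

  infixl 6 _⊖_

  -- (t - a) mod q, for a ≤ q: beyond that ∸ truncates.
  _⊖_ : ℕ → ℕ → ℕ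
  t ⊖ a = (t + (q ∸ a)) % q

  ⊖<q : ∀ t a → t ⊖ a < q
  ⊖<q t a = m%n<n (t + (q ∸ a)) q

  +≡⇒≡⊖ : ∀ {t a} x → a < q → (a + x) % q ≡ t → x % q ≡ t ⊖ a
  +≡⇒≡⊖ {t} {a} x a<q a+x≡t = begin
    x % q                                ≡⟨ [m+n]%n≡m%n x q ⟨
    (x + q) % q                          ≡⟨ cong (_% q) x+q≡a+x+[q∸a] ⟩
    ((a + x) + (q ∸ a)) % q              ≡⟨ %-distribˡ-+ (a + x) (q ∸ a) q ⟩
    ((a + x) % q + (q ∸ a) % q) % q      ≡⟨ cong (λ z → (z + (q ∸ a) % q) % q) (trans a+x≡t (sym (m<n⇒m%n≡m t<q))) ⟩
    (t % q + (q ∸ a) % q) % q            ≡⟨ %-distribˡ-+ t (q ∸ a) q ⟨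
    t ⊖ a                                ∎
    where
    t<q = subst (_< q) a+x≡t (m%n<n (a + x) q)
    x+q≡a+x+[q∸a] : x + q ≡ (a + x) + (q ∸ a)
    x+q≡a+x+[q∸a] = begin
      x + q                ≡⟨ cong (x +_) (m+[n∸m]≡n (<⇒≤ a<q)) ⟨
      x + (a + (q ∸ a))    ≡⟨ +-assoc x a (q ∸ a) ⟨
      (x + a) + (q ∸ a)    ≡⟨ cong (_+ (q ∸ a)) (+-comm x a) ⟩
      (a + x) + (q ∸ a)    ∎

  ≡⊖⇒+≡ : ∀ {t a} x → a < q → t < q → x % q ≡ t ⊖ a → (a + x) % q ≡ t
  ≡⊖⇒+≡ {t} {a} x a<q t<q x≡t⊖a = begin
    (a + x) % q                  ≡⟨ %-distribˡ-+ a x q ⟩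
    (a % q + x % q) % q          ≡⟨ cong (λ z → (a % q + z) % q) x≡t⊖a ⟩
    (a % q + (t ⊖ a)) % q        ≡⟨ %-distribˡ-+ a (t + (q ∸ a)) q ⟨
    (a + (t + (q ∸ a))) % q      ≡⟨ cong (_% q) a+[t+[q∸a]]≡t+q ⟩
    (t + q) % q                  ≡⟨ [m+n]%n≡m%n t q ⟩
    t % q                        ≡⟨ m<n⇒m%n≡m t<q ⟩
    t                            ∎
    where
    a+[t+[q∸a]]≡t+q : a + (t + (q ∸ a)) ≡ t + q
    a+[t+[q∸a]]≡t+q = begin
      a + (t + (q ∸ a))    ≡⟨ +-assoc a t (q ∸ a) ⟨
      (a + t) + (q ∸ a)    ≡⟨ cong (_+ (q ∸ a)) (+-comm a t) ⟩
      (t + a) + (q ∸ a)    ≡⟨ +-assoc t a (q ∸ a) ⟩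
      t + (a + (q ∸ a))    ≡⟨ cong (t +_) (m+[n∸m]≡n (<⇒≤ a<q)) ⟩
      t + q                ∎

  ⊖-involutive : ∀ {t a} → a < q → t < q → t ⊖ (t ⊖ a) ≡ a
  ⊖-involutive {t} {a} a<q t<q = begin
    t ⊖ (t ⊖ a)   ≡⟨ +≡⇒≡⊖ a (⊖<q t a) [t⊖a+a]%q≡t ⟨
    a % q         ≡⟨ m<n⇒m%n≡m a<q ⟩
    a             ∎
    where
    [t⊖a+a]%q≡t : (t ⊖ a + a) % q ≡ t
    [t⊖a+a]%q≡t = trans (cong (_% q) (+-comm (t ⊖ a) a)) (≡⊖⇒+≡ (t ⊖ a) a<q t<q (m<n⇒m%n≡m (⊖<q t a)))

  t⊖0≡t : ∀ {t} → t < q → t ⊖ 0 ≡ t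
  t⊖0≡t {t} t<q = trans ([m+n]%n≡m%n t q) (m<n⇒m%n≡m t<q)

  private
    [s+[i*s]%q]%q≡[1+i*s]%q : ∀ s i → s < q → (s + (i * s) % q) % q ≡ (suc i * s) % q
    [s+[i*s]%q]%q≡[1+i*s]%q s i s<q = begin
      (s + (i * s) % q) % q         ≡⟨ cong (λ z → (z + (i * s) % q) % q) (m<n⇒m%n≡m s<q) ⟨
      (s % q + (i * s) % q) % q     ≡⟨ %-distribˡ-+ s (i * s) q ⟨
      (s + i * s) % q               ∎

  ⊖≡[i*s]%q⇒≡[1+i*s]%q : ∀ {t s} i → s < q → t < q → t ⊖ s ≡ (i * s) % q → t ≡ (suc i * s) % q
  ⊖≡[i*s]%q⇒≡[1+i*s]%q {t} {s} i s<q t<q t⊖s≡ = begin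
    t                          ≡⟨ ≡⊖⇒+≡ ((i * s) % q) s<q t<q (trans (m%n%n≡m%n (i * s) q) (sym t⊖s≡)) ⟨
    (s + (i * s) % q) % q      ≡⟨ [s+[i*s]%q]%q≡[1+i*s]%q s i s<q ⟩
    (suc i * s) % q            ∎

  ≡[1+i*s]%q⇒⊖≡[i*s]%q : ∀ {t s} i → s < q → t ≡ (suc i * s) % q → t ⊖ s ≡ (i * s) % q
  ≡[1+i*s]%q⇒⊖≡[i*s]%q {t} {s} i s<q t≡ = begin
    t ⊖ s                      ≡⟨ +≡⇒≡⊖ ((i * s) % q) s<q (trans ([s+[i*s]%q]%q≡[1+i*s]%q s i s<q) (sym t≡)) ⟨
    (i * s) % q % q            ≡⟨ m%n%n≡m%n (i * s) q ⟩
    (i * s) % q                ∎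

  +-cancelʳ-% : ∀ a b c → (a + c) % q ≡ (b + c) % q → a % q ≡ b % q
  +-cancelʳ-% a b c eq = begin
    a % q                     ≡⟨ +≡⇒≡⊖ a (m%n<n c q) ([c%q+x]%q≡[x+c]%q a) ⟩
    ((a + c) % q) ⊖ (c % q)   ≡⟨ cong (_⊖ (c % q)) eq ⟩
    ((b + c) % q) ⊖ (c % q)   ≡⟨ +≡⇒≡⊖ b (m%n<n c q) ([c%q+x]%q≡[x+c]%q b) ⟨
    b % q                     ∎
    where
    [c%q+x]%q≡[x+c]%q : ∀ x → (c % q + x) % q ≡ (x + c) % q
    [c%q+x]%q≡[x+c]%q x = begin
      (c % q + x) % q           ≡⟨ %-distribˡ-+ (c % q) x q ⟩
      (c % q % q + x % q) % q   ≡⟨ cong (λ z → (z + x % q) % q) (m%n%n≡m%n c q) ⟩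
      (c % q + x % q) % q       ≡⟨ %-distribˡ-+ c x q ⟨
      (c + x) % q               ≡⟨ cong (_% q) (+-comm c x) ⟩
      (x + c) % q               ∎

module Enumeration where

  open import Defs using (allVecs)
  open import Data.Nat using (ℕ; zero; suc; _<_; NonZero)
  import Data.Nat.Properties as ℕP
  open import Data.Nat.DivMod using (_%_; m<n⇒m%n≡m)
  open import Data.Integer using (ℤ; +_; _+_)
  import Data.Integer.Properties as ℤP
  open import Data.Integer.Solver using (module +-*-Solver)
  open import Data.Fin using (Fin; zero; suc)
  open import Data.List using (List; []; _∷_; _++_; map; concatMap; applyUpTo; upTo; filter; length; deduplicate)
  import Data.List.Properties as ListP
  open import Data.List.Relation.Unary.All as All using (All; []; _∷_)
  import Data.List.Relation.Unary.All.Properties as AllP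
  open import Data.List.Relation.Unary.AllPairs as AllPairs using (AllPairs; []; _∷_)
  import Data.List.Relation.Unary.AllPairs.Properties as AllPairsP
  open import Relation.Binary.Core using (Rel)
  open import Level using (0ℓ)
  open import Relation.Binary.Definitions using (DecidableEquality)
  open import Relation.Binary.PropositionalEquality
  open import Relation.Nullary using (¬_; ¬?; Dec; yes; no)
  open FiniteSum
  open +-*-Solver
  open ≡-Reasoning

  Word : ℕ → Set
  Word k = Fin k → ℕ

  infixr 5 _◃_

  _◃_ : ∀ {k} → ℕ → Word k → Word (suc k)
  (a ◃ v) zero    = a
  (a ◃ v) (suc i) = v i

  ∑ᴸ : {A : Set} → List A → (A → ℤ) → ℤ
  ∑ᴸ []       f = + 0
  ∑ᴸ (x ∷ xs) f = f x + ∑ᴸ xs f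

  syntax ∑ᴸ xs (λ x → e) = ∑[ x ∈ xs ] e

  ∑ᴸ-++ : ∀ {A : Set} (xs ys : List A) f → ∑ᴸ (xs ++ ys) f ≡ ∑ᴸ xs f + ∑ᴸ ys f
  ∑ᴸ-++ []       ys f = sym (ℤP.+-identityˡ _)
  ∑ᴸ-++ (x ∷ xs) ys f = trans (cong (_+_ (f x)) (∑ᴸ-++ xs ys f)) (sym (ℤP.+-assoc (f x) _ _))

  module _ {A : Set} where

    ∑ᴸ-cong : ∀ (xs : List A) {f g} → (∀ x → f x ≡ g x) → ∑ᴸ xs f ≡ ∑ᴸ xs g
    ∑ᴸ-cong []       f≡g = refl
    ∑ᴸ-cong (x ∷ xs) f≡g = cong₂ _+_ (f≡g x) (∑ᴸ-cong xs f≡g)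

    ∑ᴸ-cong-All : ∀ {P : A → Set} {xs : List A} {f g} → All P xs → (∀ x → P x → f x ≡ g x) →
                  ∑ᴸ xs f ≡ ∑ᴸ xs g
    ∑ᴸ-cong-All []         f≡g = refl
    ∑ᴸ-cong-All (px ∷ pxs) f≡g = cong₂ _+_ (f≡g _ px) (∑ᴸ-cong-All pxs f≡g)

    ∑ᴸ-map : ∀ {B : Set} (h : A → B) xs f → ∑ᴸ (map h xs) f ≡ ∑[ x ∈ xs ] f (h x)
    ∑ᴸ-map h []       f = refl
    ∑ᴸ-map h (x ∷ xs) f = cong (_+_ (f (h x))) (∑ᴸ-map h xs f)

    ∑ᴸ-concatMap : ∀ {B : Set} (g : A → List B) xs f → ∑ᴸ (concatMap g xs) f ≡ ∑[ x ∈ xs ] ∑ᴸ (g x) f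
    ∑ᴸ-concatMap g []       f = refl
    ∑ᴸ-concatMap g (x ∷ xs) f = trans (∑ᴸ-++ (g x) (concatMap g xs) f) (cong (_+_ (∑ᴸ (g x) f)) (∑ᴸ-concatMap g xs f))

    ∑ᴸ-+ : ∀ (xs : List A) f g → ∑[ x ∈ xs ] (f x + g x) ≡ ∑ᴸ xs f + ∑ᴸ xs g
    ∑ᴸ-+ []       f g = refl
    ∑ᴸ-+ (x ∷ xs) f g = trans (cong (_+_ (f x + g x)) (∑ᴸ-+ xs f g))
      (solve 4 (λ a b c d → (a :+ b) :+ (c :+ d) := (a :+ c) :+ (b :+ d)) refl (f x) (g x) (∑ᴸ xs f) (∑ᴸ xs g))

    ∑ᴸ-∑ : ∀ (xs : List A) n (F : A → ℕ → ℤ) → ∑[ x ∈ xs ] ∑[ i < n ] F x i ≡ ∑[ i < n ] ∑[ x ∈ xs ] F x i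
    ∑ᴸ-∑ []       n F = sym (∑-zero n (λ _ _ → refl))
    ∑ᴸ-∑ (x ∷ xs) n F = trans (cong (_+_ (∑[ i < n ] F x i)) (∑ᴸ-∑ xs n F)) (sym (∑-+ n (F x) _))

    length-filter≡∑𝟙 : ∀ {P : A → Set} (P? : ∀ x → Dec (P x)) xs → + length (filter P? xs) ≡ ∑[ x ∈ xs ] 𝟙 (P? x)
    length-filter≡∑𝟙 P? []       = refl
    length-filter≡∑𝟙 {P} P? (x ∷ xs) = by-cases (P? x)
      where
      rest = ∑[ y ∈ xs ] 𝟙 (P? y)
      by-cases : Dec (P x) → + length (filter P? (x ∷ xs)) ≡ 𝟙 (P? x) + rest
      by-cases (yes px) = begin
        + length (filter P? (x ∷ xs))   ≡⟨ cong (λ l → + length l) (ListP.filter-accept P? px) ⟩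
        + 1 + + length (filter P? xs)   ≡⟨ cong₂ _+_ (sym (𝟙-yes (P? x) px)) (length-filter≡∑𝟙 P? xs) ⟩
        𝟙 (P? x) + rest                 ∎
      by-cases (no ¬px) = begin
        + length (filter P? (x ∷ xs))   ≡⟨ cong (λ l → + length l) (ListP.filter-reject P? ¬px) ⟩
        + length (filter P? xs)         ≡⟨ length-filter≡∑𝟙 P? xs ⟩
        rest                            ≡⟨ ℤP.+-identityˡ rest ⟨
        + 0 + rest                      ≡⟨ cong (_+ rest) (sym (𝟙-no (P? x) ¬px)) ⟩
        𝟙 (P? x) + rest                 ∎

    deduplicate-distinct : (_≟_ : DecidableEquality A) (xs : List A) → AllPairs _≢_ xs → deduplicate _≟_ xs ≡ xs
    deduplicate-distinct _≟_ []       _            = refl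
    deduplicate-distinct _≟_ (x ∷ xs) (x∉xs ∷ xs!) = cong (x ∷_) (begin
      filter x≢? (deduplicate _≟_ xs)   ≡⟨ cong (filter x≢?) (deduplicate-distinct _≟_ xs xs!) ⟩
      filter x≢? xs                     ≡⟨ ListP.filter-all x≢? x∉xs ⟩
      xs                                ∎)
      where x≢? = λ y → ¬? (x ≟ y)

  ∑-upTo : ∀ n f → ∑ᴸ (upTo n) f ≡ ∑ n f
  ∑-upTo = go (λ i → i)
    where
    go : ∀ (h : ℕ → ℕ) n f → ∑ᴸ (applyUpTo h n) f ≡ ∑[ i < n ] f (h i)
    go h zero    f = refl
    go h (suc n) f = cong (_+_ (f (h 0))) (go (λ i → h (suc i)) n f)

  Respects≗ : ∀ {k} → (Word k → ℤ) → Set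
  Respects≗ F = ∀ u v → (∀ i → u i ≡ v i) → F u ≡ F v

  -- allVecs builds a ◃ v with a pattern lambda of its own; lacking function extensionality,
  -- F has to respect pointwise equality.
  ∑-allVecs-suc : ∀ k q (F : Word (suc k) → ℤ) → Respects≗ F →
                  ∑[ u ∈ allVecs (suc k) q ] F u ≡ ∑[ a < q ] ∑[ v ∈ allVecs k q ] F (a ◃ v)
  ∑-allVecs-suc k q F F-resp = go _ (λ a v → λ { zero → refl ; (suc i) → refl })
    where
    go : ∀ (g : ℕ → Word k → Word (suc k)) → (∀ a v i → g a v i ≡ (a ◃ v) i) →
         ∑ᴸ (concatMap (λ a → map (g a) (allVecs k q)) (upTo q)) F ≡ ∑[ a < q ] ∑[ v ∈ allVecs k q ] F (a ◃ v)
    go g g≡◃ = begin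
      ∑ᴸ (concatMap (λ a → map (g a) (allVecs k q)) (upTo q)) F
        ≡⟨ ∑ᴸ-concatMap (λ a → map (g a) (allVecs k q)) (upTo q) F ⟩
      ∑[ a ∈ upTo q ] ∑ᴸ (map (g a) (allVecs k q)) F
        ≡⟨ ∑-upTo q _ ⟩
      ∑[ a < q ] ∑ᴸ (map (g a) (allVecs k q)) F
        ≡⟨ ∑-cong′ q (λ a → trans (∑ᴸ-map (g a) (allVecs k q) F)
           (∑ᴸ-cong (allVecs k q) (λ v → F-resp _ _ (g≡◃ a v)))) ⟩
      ∑[ a < q ] ∑[ v ∈ allVecs k q ] F (a ◃ v) ∎

  private
    All-allVecs-suc : ∀ k q (g : ℕ → Word k → Word (suc k)) {P : Word k → Set} {Q : Word (suc k) → Set} →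
                      All P (allVecs k q) → (∀ {a v} → a < q → P v → Q (g a v)) →
                      All Q (concatMap (λ a → map (g a) (allVecs k q)) (upTo q))
    All-allVecs-suc k q g all-P P⇒Q =
      AllP.concat⁺ (AllP.map⁺ (AllP.applyUpTo⁺₁ (λ i → i) q (λ a<q → AllP.map⁺ (All.map (P⇒Q a<q) all-P))))

    AllPairs-allVecs-suc : ∀ k q (g : ℕ → Word k → Word (suc k)) {R : Rel (Word k) 0ℓ} {S : Rel (Word (suc k)) 0ℓ} →
                           AllPairs R (allVecs k q) → (∀ a {u v} → R u v → S (g a u) (g a v)) →
                           (∀ {a b} → a < b → b < q → ∀ u v → S (g a u) (g b v)) →
                           AllPairs S (concatMap (λ a → map (g a) (allVecs k q)) (upTo q))
    AllPairs-allVecs-suc k q g R-pairs same-head different-heads =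
      AllPairsP.concat⁺
        (AllP.map⁺ (AllP.applyUpTo⁺₁ (λ i → i) q (λ {a} _ → AllPairsP.map⁺ (AllPairs.map (same-head a) R-pairs))))
        (AllPairsP.map⁺ (AllPairsP.applyUpTo⁺₁ (λ i → i) q (λ a<b b<q →
          AllP.map⁺ (All.universal (λ u → AllP.map⁺ (All.universal (different-heads a<b b<q u) (allVecs k q))) (allVecs k q)))))

  Bounded : ℕ → ∀ {k} → Word k → Set
  Bounded q u = ∀ i → u i < q

  allVecs-bounded : ∀ k q → All (Bounded q) (allVecs k q)
  allVecs-bounded zero    q = (λ ()) ∷ []
  allVecs-bounded (suc k) q =
    All-allVecs-suc k q _ (allVecs-bounded k q) (λ a<q u<q → λ { zero → a<q ; (suc i) → u<q i })

  DistinctMod : ∀ q .{{_ : NonZero q}} {k} → Word k → Word k → Set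
  DistinctMod q u v = ¬ (∀ i → u i % q ≡ v i % q)

  allVecs-distinct : ∀ k q .{{_ : NonZero q}} → AllPairs (DistinctMod q) (allVecs k q)
  allVecs-distinct zero    q = [] ∷ []
  allVecs-distinct (suc k) q = AllPairs-allVecs-suc k q _ (allVecs-distinct k q)
    (λ a u≉v u≈v → u≉v (λ i → u≈v (suc i)))
    (λ a<b b<q u v a◃u≈b◃v →
      ℕP.<⇒≢ a<b (trans (sym (m<n⇒m%n≡m (ℕP.<-trans a<b b<q))) (trans (a◃u≈b◃v zero) (m<n⇒m%n≡m b<q))))

module WeightCount where

  open import Defs using (allVecs)
  open import Data.Nat as ℕ using (ℕ; zero; suc; _<_; z≤n; s≤s; NonZero)
  import Data.Nat.Properties as ℕP
  open import Data.Nat.DivMod using (_%_; m%n<n; m*n%n≡0)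
  open import Data.Integer as ℤ using (ℤ; +_; _+_; _*_; -_; _-_)
  import Data.Integer.Properties as ℤP
  open import Data.Integer.Solver using (module +-*-Solver)
  open import Algebra.Properties.CommutativeMonoid.Sum ℕP.+-0-commutativeMonoid using (sum; sum-cong-≗)
  open import Data.Bool using (if_then_else_)
  open import Relation.Binary.PropositionalEquality
  open import Relation.Nullary using (does)
  open import Relation.Nullary.Decidable using (dec-true; dec-false; does-⇔)
  open import Function.Bundles using (mk⇔)
  open FiniteSum
  open Enumeration
  open +-*-Solver
  open ≡-Reasoning

  𝟙≢ : ℕ → ℕ → ℕ
  𝟙≢ a b = if does (a ℕ.≟ b) then 0 else 1

  𝟙≢-refl : ∀ a → 𝟙≢ a a ≡ 0
  𝟙≢-refl a = cong (if_then 0 else 1) (dec-true (a ℕ.≟ a) refl)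

  𝟙≢-≢ : ∀ {a b} → a ≢ b → 𝟙≢ a b ≡ 1
  𝟙≢-≢ {a} {b} a≢b = cong (if_then 0 else 1) (dec-false (a ℕ.≟ b) a≢b)

  𝟙≢-cong : ∀ {a b c d} → (a ≡ b → c ≡ d) → (c ≡ d → a ≡ b) → 𝟙≢ a b ≡ 𝟙≢ c d
  𝟙≢-cong {a} {b} {c} {d} ⇒ ⇐ = cong (if_then 0 else 1) (does-⇔ (mk⇔ ⇒ ⇐) (a ℕ.≟ b) (c ℕ.≟ d))

  -- With s = Σ u mod q, the codeword uÑ_k has entries u_i and s - u_i, so u_i contributes
  -- symbolWeight s (u i) to its weight.
  symbolWeight : ℕ → ℕ → ℕ
  symbolWeight s a = 𝟙≢ a 0 ℕ.+ 𝟙≢ a s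

  weight : ∀ {k} → ℕ → Word k → ℕ
  weight s u = sum (λ i → symbolWeight s (u i))

  symbolWeight-0 : ∀ {s} → s ≢ 0 → symbolWeight s 0 ≡ 1
  symbolWeight-0 s≢0 = cong₂ ℕ._+_ (𝟙≢-refl 0) (𝟙≢-≢ (λ 0≡s → s≢0 (sym 0≡s)))

  symbolWeight-s : ∀ {s} → s ≢ 0 → symbolWeight s s ≡ 1
  symbolWeight-s {s} s≢0 = cong₂ ℕ._+_ (𝟙≢-≢ s≢0) (𝟙≢-refl s)

  symbolWeight-other : ∀ {s a} → a ≢ 0 → a ≢ s → symbolWeight s a ≡ 2
  symbolWeight-other a≢0 a≢s = cong₂ ℕ._+_ (𝟙≢-≢ a≢0) (𝟙≢-≢ a≢s)

  mul1+X : (ℕ → ℤ) → ℕ → ℤ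
  mul1+X a zero    = a zero
  mul1+X a (suc i) = a (suc i) + a i

  -- α k i w is the coefficient of X^i Y^w in ((1 + X)(Y - Y²))^k, and α₀ k w that of Y^w in (1 - Y²)^k.
  α : ℕ → ℕ → ℤ → ℤ
  α zero    i w = 𝟙 (i ℕ.≟ 0) * 𝟙 (w ℤ.≟ + 0)
  α (suc k) i w = mul1+X (λ j → α k j (w - + 1) - α k j (w - + 2)) i

  ∑α : ℕ → ℤ → ℤ
  ∑α k w = ∑[ i < suc k ] α k i w

  β : ℕ → ℕ → ℤ → ℤ
  β zero    q w = + 0
  β (suc k) q w = + 2 * β k q (w - + 1) + (+ q * β k q (w - + 2) + ∑α k (w - + 2)) - + 2 * β k q (w - + 2)

  α₀ : ℕ → ℤ → ℤ
  α₀ zero    w = 𝟙 (w ℤ.≟ + 0)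
  α₀ (suc k) w = α₀ k w - α₀ k (w - + 2)

  β₀ : ℕ → ℕ → ℤ → ℤ
  β₀ zero    q w = + 0
  β₀ (suc k) q w = β₀ k q w + (+ q * β₀ k q (w - + 2) + α₀ k (w - + 2)) - β₀ k q (w - + 2)

  α-vanish : ∀ k i w → k < i → α k i w ≡ + 0
  α-vanish zero    (suc i) w _         =
    trans (cong (_* 𝟙 (w ℤ.≟ + 0)) (𝟙-no (suc i ℕ.≟ 0) λ ())) (ℤP.*-zeroˡ (𝟙 (w ℤ.≟ + 0)))
  α-vanish (suc k) (suc i) w (s≤s k<i) =
    cong₂ _+_ (cong₂ _-_ (α-vanish k (suc i) _ (ℕP.m<n⇒m<1+n k<i)) (α-vanish k (suc i) _ (ℕP.m<n⇒m<1+n k<i)))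
              (cong₂ _-_ (α-vanish k i _ k<i) (α-vanish k i _ k<i))

  ∑-mul1+X : ∀ n (a X : ℕ → ℤ) → a n ≡ + 0 →
             ∑[ i < suc n ] (mul1+X a i * X i) ≡ ∑[ i < n ] (a i * (X i + X (suc i)))
  ∑-mul1+X zero    a X a0≡0 = cong (λ z → z * X 0 + + 0) a0≡0
  ∑-mul1+X (suc n) a X aₙ≡0 = begin
    a 0 * X 0 + ((a 1 + a 0) * X 1 + ∑[ i < n ] (mul1+X a (2 ℕ.+ i) * X (2 ℕ.+ i)))
      ≡⟨ solve 5 (λ a0 a1 x0 x1 r → a0 :* x0 :+ ((a1 :+ a0) :* x1 :+ r) := a0 :* (x0 :+ x1) :+ (a1 :* x1 :+ r))
         refl (a 0) (a 1) (X 0) (X 1) _ ⟩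
    a 0 * (X 0 + X 1) + ∑[ i < suc n ] (mul1+X a′ i * X′ i)
      ≡⟨ cong (_+_ (a 0 * (X 0 + X 1))) (∑-mul1+X n a′ X′ aₙ≡0) ⟩
    a 0 * (X 0 + X 1) + ∑[ i < n ] (a′ i * (X′ i + X′ (suc i))) ∎
    where
    a′ = λ i → a (suc i)
    X′ = λ i → X (suc i)

  ∑α-suc : ∀ k w (X : ℕ → ℤ) →
           ∑[ i < suc (suc k) ] (α (suc k) i w * X i) ≡
           (∑[ i < suc k ] (α k i (w - + 1) * X i) - ∑[ i < suc k ] (α k i (w - + 2) * X i)) +
           (∑[ i < suc k ] (α k i (w - + 1) * X (suc i)) - ∑[ i < suc k ] (α k i (w - + 2) * X (suc i)))
  ∑α-suc k w X = trans (∑-mul1+X (suc k) (λ j → α k j w₁ - α k j w₂) X Δₖ₊₁≡0)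
                       (∑-[a-b]*[x+y] (suc k) (λ i → α k i w₁) (λ i → α k i w₂) X (λ i → X (suc i)))
    where
    w₁ = w - + 1
    w₂ = w - + 2
    Δₖ₊₁≡0 : α k (suc k) w₁ - α k (suc k) w₂ ≡ + 0
    Δₖ₊₁≡0 = cong₂ _-_ (α-vanish k (suc k) w₁ (ℕP.n<1+n k)) (α-vanish k (suc k) w₂ (ℕP.n<1+n k))

  private
    +c+x≡w⇒x≡w-c : ∀ c x w → + c + x ≡ w → x ≡ w - + c
    +c+x≡w⇒x≡w-c c x w eq = trans (solve 2 (λ c x → x := (c :+ x) :- c) refl (+ c) x) (cong (_- + c) eq)

    x≡w-c⇒+c+x≡w : ∀ c x w → x ≡ w - + c → + c + x ≡ w
    x≡w-c⇒+c+x≡w c x w eq = trans (cong (_+_ (+ c)) eq) (solve 2 (λ c w → c :+ (w :- c) := w) refl (+ c) w)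

  module Counting (q : ℕ) .{{_ : NonZero q}} where

    open Residue q

    count : ℕ → ℕ → ℕ → ℤ → ℤ
    count k s t w = ∑[ u ∈ allVecs k q ] (𝟙 (sum u % q ℕ.≟ t) * 𝟙 (+ weight s u ℤ.≟ w))

    countAll : ℕ → ℕ → ℤ → ℤ
    countAll k s w = ∑[ t < q ] count k s t w

    count-suc : ∀ k s t w → t < q → count (suc k) s t w ≡ ∑[ a < q ] count k s (t ⊖ a) (w - + symbolWeight s a)
    count-suc k s t w t<q = trans (∑-allVecs-suc k q _ count-resp)
      (∑-cong q (λ a a<q → ∑ᴸ-cong (allVecs k q) (λ v → cong₂ _*_ (sum-condition a<q v) (weight-condition a v))))
      where
      sum-condition : ∀ {a} → a < q → ∀ v → 𝟙 ((a ℕ.+ sum v) % q ℕ.≟ t) ≡ 𝟙 (sum v % q ℕ.≟ t ⊖ a)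
      sum-condition {a} a<q v = 𝟙-cong (+≡⇒≡⊖ (sum v) a<q) (≡⊖⇒+≡ (sum v) a<q t<q)
      weight-condition : ∀ a v → 𝟙 (+ (symbolWeight s a ℕ.+ weight s v) ℤ.≟ w)
                               ≡ 𝟙 (+ weight s v ℤ.≟ w - + symbolWeight s a)
      weight-condition a v = 𝟙-cong (+c+x≡w⇒x≡w-c _ _ w) (x≡w-c⇒+c+x≡w _ _ w)
      count-resp : Respects≗ (λ u → 𝟙 (sum u % q ℕ.≟ t) * 𝟙 (+ weight s u ℤ.≟ w))
      count-resp u v u≗v = cong₂ (λ x y → 𝟙 (x % q ℕ.≟ t) * 𝟙 (+ y ℤ.≟ w))
                                 (sum-cong-≗ u≗v) (sum-cong-≗ (λ i → cong (symbolWeight s) (u≗v i)))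

    ∑-count-⊖ : ∀ k s t w → t < q → ∑[ a < q ] count k s (t ⊖ a) w ≡ countAll k s w
    ∑-count-⊖ k s t w t<q =
      ∑-involution q (t ⊖_) (λ a _ → ⊖<q t a) (λ a a<q → ⊖-involutive a<q t<q) (λ b → count k s b w)

    count-suc-≢0 : ∀ k s t w → 0 < s → s < q → t < q →
                   count (suc k) s t w ≡ countAll k s (w - + 2) + (count k s t (w - + 1) - count k s t (w - + 2))
                                         + (count k s (t ⊖ s) (w - + 1) - count k s (t ⊖ s) (w - + 2))
    count-suc-≢0 k s t w 0<s s<q t<q = begin
      count (suc k) s t w
        ≡⟨ count-suc k s t w t<q ⟩
      ∑ q f
        ≡⟨ ∑-differ-at₂ q f g 0 s (ℕP.<-trans 0<s s<q) s<q (ℕP.<⇒≢ 0<s) f≡g ⟩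
      ∑ q g + (f 0 - g 0) + (f s - g s)
        ≡⟨ cong₂ _+_ (cong₂ _+_ (∑-count-⊖ k s t w₂ t<q) f₀-g₀) fₛ-gₛ ⟩
      countAll k s w₂ + (C t w₁ - C t w₂) + (C (t ⊖ s) w₁ - C (t ⊖ s) w₂) ∎
      where
      C = count k s
      w₁ = w - + 1
      w₂ = w - + 2
      f = λ a → C (t ⊖ a) (w - + symbolWeight s a)
      g = λ a → C (t ⊖ a) w₂
      f≡g : ∀ a → a ≢ 0 → a ≢ s → f a ≡ g a
      f≡g a a≢0 a≢s = cong (λ c → C (t ⊖ a) (w - + c)) (symbolWeight-other a≢0 a≢s)
      s≢0 : s ≢ 0
      s≢0 s≡0 = ℕP.<⇒≢ 0<s (sym s≡0)
      f₀-g₀ : f 0 - g 0 ≡ C t w₁ - C t w₂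
      f₀-g₀ = cong₂ (λ b c → C b (w - + c) - C b w₂) (t⊖0≡t t<q) (symbolWeight-0 s≢0)
      fₛ-gₛ : f s - g s ≡ C (t ⊖ s) w₁ - C (t ⊖ s) w₂
      fₛ-gₛ = cong (λ c → C (t ⊖ s) (w - + c) - C (t ⊖ s) w₂) (symbolWeight-s s≢0)

    count-suc-0 : ∀ k t w → t < q → count (suc k) 0 t w ≡ countAll k 0 (w - + 2) + (count k 0 t w - count k 0 t (w - + 2))
    count-suc-0 k t w t<q = begin
      count (suc k) 0 t w
        ≡⟨ count-suc k 0 t w t<q ⟩
      ∑ q f
        ≡⟨ ∑-differ-at₁ q f g 0 (ℕP.≤-<-trans z≤n t<q) f≡g ⟩
      ∑ q g + (f 0 - g 0)
        ≡⟨ cong₂ _+_ (∑-count-⊖ k 0 t w₂ t<q) f₀-g₀ ⟩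
      countAll k 0 w₂ + (C t w - C t w₂) ∎
      where
      C = count k 0
      w₂ = w - + 2
      f = λ a → C (t ⊖ a) (w - + symbolWeight 0 a)
      g = λ a → C (t ⊖ a) w₂
      f≡g : ∀ a → a ≢ 0 → f a ≡ g a
      f≡g a a≢0 = cong (λ c → C (t ⊖ a) (w - + c)) (symbolWeight-other a≢0 a≢0)
      f₀-g₀ : f 0 - g 0 ≡ C t w - C t w₂
      f₀-g₀ = cong₂ (λ b w′ → C b w′ - C b w₂) (t⊖0≡t t<q) (ℤP.+-identityʳ w)

    private
      0%q≡0 : 0 % q ≡ 0
      0%q≡0 = m*n%n≡0 0 q

    count-zero : ∀ s t w → count 0 s t w ≡ 𝟙 (w ℤ.≟ + 0) * 𝟙 (t ℕ.≟ 0)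
    count-zero s t w = begin
      𝟙 (0 % q ℕ.≟ t) * 𝟙 (+ 0 ℤ.≟ w) + + 0   ≡⟨ ℤP.+-identityʳ _ ⟩
      𝟙 (0 % q ℕ.≟ t) * 𝟙 (+ 0 ℤ.≟ w)         ≡⟨ ℤP.*-comm (𝟙 (0 % q ℕ.≟ t)) _ ⟩
      𝟙 (+ 0 ℤ.≟ w) * 𝟙 (0 % q ℕ.≟ t)         ≡⟨ cong₂ _*_ (𝟙-cong sym sym)
                                                         (𝟙-cong (λ e → trans (sym e) 0%q≡0) (λ e → trans 0%q≡0 (sym e))) ⟩
      𝟙 (w ℤ.≟ + 0) * 𝟙 (t ℕ.≟ 0)             ∎

    module _ (k s : ℕ) (w : ℤ) where

      ClosedForm : ℕ → Set
      ClosedForm t = count k s t w ≡ β k q w + ∑[ i < suc k ] (α k i w * 𝟙 (t ℕ.≟ (i ℕ.* s) % q))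

      countAll-closed : (∀ t → t < q → ClosedForm t) → countAll k s w ≡ + q * β k q w + ∑α k w
      countAll-closed closed = begin
        ∑[ t < q ] count k s t w
          ≡⟨ ∑-cong q closed ⟩
        ∑[ t < q ] (β k q w + ∑[ i < suc k ] (α k i w * X t i))
          ≡⟨ ∑-+ q (λ _ → β k q w) _ ⟩
        ∑[ _ < q ] β k q w + ∑[ t < q ] ∑[ i < suc k ] (α k i w * X t i)
          ≡⟨ cong₂ _+_ (∑-const q (β k q w)) (∑-swap q (suc k) (λ t i → α k i w * X t i)) ⟩
        + q * β k q w + ∑[ i < suc k ] ∑[ t < q ] (α k i w * X t i)
          ≡⟨ cong (_+_ (+ q * β k q w)) (∑-cong′ (suc k) each-i) ⟩
        + q * β k q w + ∑α k w ∎
        where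
        X = λ t i → 𝟙 (t ℕ.≟ (i ℕ.* s) % q)
        each-i : ∀ i → ∑[ t < q ] (α k i w * X t i) ≡ α k i w
        each-i i = trans (∑-*ˡ q (α k i w) (λ t → X t i))
                         (trans (cong (α k i w *_) (∑-𝟙 q _ (m%n<n (i ℕ.* s) q))) (ℤP.*-identityʳ _))

    module _ (k : ℕ) (w : ℤ) where

      ClosedForm₀ : ℕ → Set
      ClosedForm₀ t = count k 0 t w ≡ β₀ k q w + α₀ k w * 𝟙 (t ℕ.≟ 0)

      countAll-closed₀ : (∀ t → t < q → ClosedForm₀ t) → countAll k 0 w ≡ + q * β₀ k q w + α₀ k w
      countAll-closed₀ closed = begin
        ∑[ t < q ] count k 0 t w
          ≡⟨ ∑-cong q closed ⟩
        ∑[ t < q ] (β₀ k q w + α₀ k w * 𝟙 (t ℕ.≟ 0))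
          ≡⟨ ∑-+ q (λ _ → β₀ k q w) _ ⟩
        ∑[ _ < q ] β₀ k q w + ∑[ t < q ] (α₀ k w * 𝟙 (t ℕ.≟ 0))
          ≡⟨ cong₂ _+_ (∑-const q (β₀ k q w)) (∑-*ˡ q (α₀ k w) _) ⟩
        + q * β₀ k q w + α₀ k w * ∑[ t < q ] 𝟙 (t ℕ.≟ 0)
          ≡⟨ cong (λ z → + q * β₀ k q w + α₀ k w * z) (∑-𝟙 q 0 (ℕ.>-nonZero⁻¹ q)) ⟩
        + q * β₀ k q w + α₀ k w * + 1
          ≡⟨ cong (_+_ (+ q * β₀ k q w)) (ℤP.*-identityʳ _) ⟩
        + q * β₀ k q w + α₀ k w ∎

    closed-form : ∀ k s t w → 0 < s → s < q → t < q → ClosedForm k s w t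
    closed-form zero s t w _ _ _ = begin
      count 0 s t w
        ≡⟨ count-zero s t w ⟩
      𝟙 (w ℤ.≟ + 0) * 𝟙 (t ℕ.≟ 0)
        ≡⟨ solve 2 (λ x y → x :* y := con (+ 0) :+ (con (+ 1) :* x :* y :+ con (+ 0)))
                 refl (𝟙 (w ℤ.≟ + 0)) (𝟙 (t ℕ.≟ 0)) ⟩
      + 0 + (+ 1 * 𝟙 (w ℤ.≟ + 0) * 𝟙 (t ℕ.≟ 0) + + 0)
        ≡⟨ cong₂ (λ a b → + 0 + (a * 𝟙 (w ℤ.≟ + 0) * b + + 0))
                 (sym (𝟙-yes (0 ℕ.≟ 0) refl)) (𝟙-cong (λ e → trans e (sym 0%q≡0)) (λ e → trans e 0%q≡0)) ⟩
      β 0 q w + ∑[ i < 1 ] (α 0 i w * 𝟙 (t ℕ.≟ (i ℕ.* s) % q)) ∎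
    closed-form (suc k) s t w 0<s s<q t<q = begin
      count (suc k) s t w
        ≡⟨ count-suc-≢0 k s t w 0<s s<q t<q ⟩
      countAll k s w₂ + (count k s t w₁ - count k s t w₂) + (count k s t′ w₁ - count k s t′ w₂)
        ≡⟨ cong₂ (λ x y → x + y + (count k s t′ w₁ - count k s t′ w₂))
                 (countAll-closed k s w₂ (λ b → IH b w₂)) (cong₂ _-_ (IH t w₁ t<q) (IH t w₂ t<q)) ⟩
      (+ q * B₂ + A₂) + ((B₁ + S₁) - (B₂ + S₂)) + (count k s t′ w₁ - count k s t′ w₂)
        ≡⟨ cong (_+_ ((+ q * B₂ + A₂) + ((B₁ + S₁) - (B₂ + S₂))))
                (cong₂ _-_ (trans (IH t′ w₁ t′<q) (cong (_+_ B₁) (shift w₁)))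
                           (trans (IH t′ w₂ t′<q) (cong (_+_ B₂) (shift w₂)))) ⟩
      (+ q * B₂ + A₂) + ((B₁ + S₁) - (B₂ + S₂)) + ((B₁ + S₁′) - (B₂ + S₂′))
        ≡⟨ solve 8 (λ q B₁ B₂ A₂ S₁ S₂ S₁′ S₂′ →
                      (q :* B₂ :+ A₂) :+ ((B₁ :+ S₁) :- (B₂ :+ S₂)) :+ ((B₁ :+ S₁′) :- (B₂ :+ S₂′))
                   := (con (+ 2) :* B₁ :+ (q :* B₂ :+ A₂) :- con (+ 2) :* B₂) :+ ((S₁ :- S₂) :+ (S₁′ :- S₂′)))
                   refl (+ q) B₁ B₂ A₂ S₁ S₂ S₁′ S₂′ ⟩
      β (suc k) q w + ((S₁ - S₂) + (S₁′ - S₂′))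
        ≡⟨ cong (_+_ (β (suc k) q w)) (∑α-suc k w X) ⟨
      β (suc k) q w + ∑[ i < suc (suc k) ] (α (suc k) i w * X i) ∎
      where
      IH : ∀ b w′ → b < q → ClosedForm k s w′ b
      IH b w′ = closed-form k s b w′ 0<s s<q
      w₁ = w - + 1
      w₂ = w - + 2
      t′ = t ⊖ s
      t′<q = ⊖<q t s
      X = λ i → 𝟙 (t ℕ.≟ (i ℕ.* s) % q)
      B₁ = β k q w₁
      B₂ = β k q w₂
      A₂ = ∑α k w₂
      S₁ = ∑[ i < suc k ] (α k i w₁ * X i)
      S₂ = ∑[ i < suc k ] (α k i w₂ * X i)
      S₁′ = ∑[ i < suc k ] (α k i w₁ * X (suc i))
      S₂′ = ∑[ i < suc k ] (α k i w₂ * X (suc i))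
      shift : ∀ w′ → ∑[ i < suc k ] (α k i w′ * 𝟙 (t′ ℕ.≟ (i ℕ.* s) % q))
                   ≡ ∑[ i < suc k ] (α k i w′ * X (suc i))
      shift w′ = ∑-cong′ (suc k) (λ i → cong (α k i w′ *_) (shift-indicator i))
        where
        shift-indicator : ∀ i → 𝟙 (t′ ℕ.≟ (i ℕ.* s) % q) ≡ X (suc i)
        shift-indicator i = 𝟙-cong (⊖≡[i*s]%q⇒≡[1+i*s]%q i s<q t<q) (≡[1+i*s]%q⇒⊖≡[i*s]%q i s<q)

    closed-form₀ : ∀ k t w → t < q → ClosedForm₀ k w t
    closed-form₀ zero    t w _   = trans (count-zero 0 t w) (sym (ℤP.+-identityˡ _))
    closed-form₀ (suc k) t w t<q = begin
      count (suc k) 0 t w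
        ≡⟨ count-suc-0 k t w t<q ⟩
      countAll k 0 w₂ + (count k 0 t w - count k 0 t w₂)
        ≡⟨ cong₂ _+_ (countAll-closed₀ k w₂ (λ b b<q → closed-form₀ k b w₂ b<q))
                     (cong₂ _-_ (closed-form₀ k t w t<q) (closed-form₀ k t w₂ t<q)) ⟩
      (+ q * β₀ k q w₂ + α₀ k w₂) + ((β₀ k q w + α₀ k w * X) - (β₀ k q w₂ + α₀ k w₂ * X))
        ≡⟨ solve 6 (λ q b₂ a₂ b a x → (q :* b₂ :+ a₂) :+ ((b :+ a :* x) :- (b₂ :+ a₂ :* x))
                                     := (b :+ (q :* b₂ :+ a₂) :- b₂) :+ (a :- a₂) :* x)
                   refl (+ q) (β₀ k q w₂) (α₀ k w₂) (β₀ k q w) (α₀ k w) X ⟩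
      β₀ (suc k) q w + α₀ (suc k) w * X ∎
      where
      w₂ = w - + 2
      X = 𝟙 (t ℕ.≟ 0)

  fixedCount : ℕ → ℕ → ℤ
  fixedCount q′ i = ∑[ s < q′ ] 𝟙 (suc s ℕ.≟ (i ℕ.* suc s) % suc q′)

  closedCount : ℕ → ℤ → ℤ → ℕ → ℤ
  closedCount k w₀ w₁ q =
    β₀ k q w₀ + α₀ k w₀ + (+ q - + 1) * β k q w₁ + ∑[ i < suc k ] (α k i w₁ * fixedCount (ℕ.pred q) i)

  module _ (k q′ : ℕ) where

    private
      q = suc q′
    open Counting q

    private
      count-0-0 : ∀ w₀ → count k 0 0 w₀ ≡ β₀ k q w₀ + α₀ k w₀
      count-0-0 w₀ = begin
        count k 0 0 w₀                     ≡⟨ closed-form₀ k 0 w₀ (s≤s z≤n) ⟩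
        β₀ k q w₀ + α₀ k w₀ * 𝟙 (0 ℕ.≟ 0)  ≡⟨ cong (λ x → β₀ k q w₀ + α₀ k w₀ * x) (𝟙-yes _ refl) ⟩
        β₀ k q w₀ + α₀ k w₀ * + 1          ≡⟨ cong (_+_ (β₀ k q w₀)) (ℤP.*-identityʳ (α₀ k w₀)) ⟩
        β₀ k q w₀ + α₀ k w₀                ∎

      ∑-count-s-s : ∀ w₁ → ∑[ s < q′ ] count k (suc s) (suc s) w₁
                         ≡ + q′ * β k q w₁ + ∑[ i < suc k ] (α k i w₁ * fixedCount q′ i)
      ∑-count-s-s w₁ = begin
        ∑[ s < q′ ] count k (suc s) (suc s) w₁
          ≡⟨ ∑-cong q′ (λ s s<q′ → closed-form k (suc s) (suc s) w₁ (s≤s z≤n) (s≤s s<q′) (s≤s s<q′)) ⟩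
        ∑[ s < q′ ] (β k q w₁ + ∑[ i < suc k ] (α k i w₁ * X s i))
          ≡⟨ ∑-+ q′ (λ _ → β k q w₁) _ ⟩
        ∑[ _ < q′ ] β k q w₁ + ∑[ s < q′ ] ∑[ i < suc k ] (α k i w₁ * X s i)
          ≡⟨ cong₂ _+_ (∑-const q′ (β k q w₁)) (∑-swap q′ (suc k) (λ s i → α k i w₁ * X s i)) ⟩
        + q′ * β k q w₁ + ∑[ i < suc k ] ∑[ s < q′ ] (α k i w₁ * X s i)
          ≡⟨ cong (_+_ (+ q′ * β k q w₁)) (∑-cong′ (suc k) (λ i → ∑-*ˡ q′ (α k i w₁) (λ s → X s i))) ⟩
        + q′ * β k q w₁ + ∑[ i < suc k ] (α k i w₁ * fixedCount q′ i) ∎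
        where
        X = λ s i → 𝟙 (suc s ℕ.≟ (i ℕ.* suc s) % q)

    ∑-diagonal-count : ∀ w₀ w₁ → count k 0 0 w₀ + ∑[ s < q′ ] count k (suc s) (suc s) w₁ ≡ closedCount k w₀ w₁ q
    ∑-diagonal-count w₀ w₁ = trans (cong₂ _+_ (count-0-0 w₀) (∑-count-s-s w₁))
      (sym (ℤP.+-assoc (β₀ k q w₀ + α₀ k w₀) (+ q′ * β k q w₁) (∑[ i < suc k ] (α k i w₁ * fixedCount q′ i))))

    ∑-by-residue : ∀ (F : ℕ → Word k → ℤ) →
                   ∑[ u ∈ allVecs k q ] F (sum u % q) u ≡ ∑[ s < q ] ∑[ u ∈ allVecs k q ] (𝟙 (sum u % q ℕ.≟ s) * F s u)
    ∑-by-residue F =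
      trans (∑ᴸ-cong (allVecs k q) split-u) (∑ᴸ-∑ (allVecs k q) q (λ u s → 𝟙 (sum u % q ℕ.≟ s) * F s u))
      where
      split-u : ∀ u → F (sum u % q) u ≡ ∑[ s < q ] (𝟙 (sum u % q ℕ.≟ s) * F s u)
      split-u u = sym (trans (∑-cong′ q (λ s → cong (_* F s u) (𝟙-sym (sum u % q) s)))
                             (∑-𝟙* q (sum u % q) (λ s → F s u) (m%n<n (sum u) q)))

    ∑-weight≡closedCount : ∀ j → ∑[ u ∈ allVecs k q ] 𝟙 (weight (sum u % q) u ℕ.≟ j) ≡ closedCount k (+ j) (+ j) q
    ∑-weight≡closedCount j = begin
      ∑[ u ∈ allVecs k q ] 𝟙 (weight (sum u % q) u ℕ.≟ j)
        ≡⟨ ∑ᴸ-cong (allVecs k q) (λ u → 𝟙-cong (cong (λ n → + n)) ℤP.+-injective) ⟩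
      ∑[ u ∈ allVecs k q ] 𝟙 (+ weight (sum u % q) u ℤ.≟ + j)
        ≡⟨ ∑-by-residue (λ s u → 𝟙 (+ weight s u ℤ.≟ + j)) ⟩
      ∑[ s < q ] count k s s (+ j)
        ≡⟨ ∑-diagonal-count (+ j) (+ j) ⟩
      closedCount k (+ j) (+ j) q ∎

    ∑-weight+𝟙≢≡closedCount : ∀ j → ∑[ u ∈ allVecs k q ] 𝟙 (weight (sum u % q) u ℕ.+ 𝟙≢ (sum u % q) 0 ℕ.≟ j)
                                    ≡ closedCount k (+ j) (+ j - + 1) q
    ∑-weight+𝟙≢≡closedCount j = begin
      ∑[ u ∈ allVecs k q ] 𝟙 (weight (sum u % q) u ℕ.+ 𝟙≢ (sum u % q) 0 ℕ.≟ j)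
        ≡⟨ ∑ᴸ-cong (allVecs k q) (λ u → 𝟙-cong (shift _ _) (unshift (weight (sum u % q) u) _)) ⟩
      ∑[ u ∈ allVecs k q ] 𝟙 (+ weight (sum u % q) u ℤ.≟ + j - + 𝟙≢ (sum u % q) 0)
        ≡⟨ ∑-by-residue (λ s u → 𝟙 (+ weight s u ℤ.≟ + j - + 𝟙≢ s 0)) ⟩
      count k 0 0 (+ j - + 𝟙≢ 0 0) + ∑[ s < q′ ] count k (suc s) (suc s) (+ j - + 𝟙≢ (suc s) 0)
        ≡⟨ cong₂ (λ x y → count k 0 0 x + y) (trans (cong (λ c → + j - + c) (𝟙≢-refl 0)) (ℤP.+-identityʳ (+ j)))
                 (∑-cong′ q′ (λ s → cong (λ c → count k (suc s) (suc s) (+ j - + c)) (𝟙≢-≢ {suc s} {0} λ ()))) ⟩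
      count k 0 0 (+ j) + ∑[ s < q′ ] count k (suc s) (suc s) (+ j - + 1)
        ≡⟨ ∑-diagonal-count (+ j) (+ j - + 1) ⟩
      closedCount k (+ j) (+ j - + 1) q ∎
      where
      shift : ∀ x c → x ℕ.+ c ≡ j → + x ≡ + j - + c
      shift x c eq = +c+x≡w⇒x≡w-c c (+ x) (+ j) (cong (λ n → + n) (trans (ℕP.+-comm c x) eq))
      unshift : ∀ x c → + x ≡ + j - + c → x ℕ.+ c ≡ j
      unshift x c eq = trans (ℕP.+-comm x c) (ℤP.+-injective (x≡w-c⇒+c+x≡w c (+ x) (+ j) eq))

module CodeWeight where

  open import Defs
  open import Data.Nat as ℕ using (ℕ; zero; suc; NonZero)
  import Data.Nat.Properties as ℕP
  open import Data.Nat.DivMod using (_%_; m<n⇒m%n≡m; %-remove-+ˡ; m*n%n≡0)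
  open import Data.Nat.Divisibility using (m%n≡0⇒n∣m)
  open import Data.Integer as ℤ using (ℤ; +_; _%ℕ_)
  import Data.Integer.Properties as ℤP
  open import Data.Fin as Fin using (Fin; zero; suc; _↑ˡ_; _↑ʳ_)
  import Data.Fin.Properties as FinP
  open import Data.List using (map; filter; length; tabulate; allFin)
  import Data.List.Properties as ListP
  open import Data.List.Relation.Unary.AllPairs as AllPairs using (AllPairs)
  import Data.List.Relation.Unary.AllPairs.Properties as AllPairsP
  open import Algebra.Properties.CommutativeMonoid.Sum ℕP.+-0-commutativeMonoid using (sum; sum-cong-≗; ∑-distrib-+)
  open import Algebra.Properties.CommutativeMonoid.Sum ℤP.+-0-commutativeMonoid
    using () renaming (sum to sumᶻ; sum-cong-≗ to sumᶻ-cong-≗; sum-replicate-zero to sumᶻ-zero)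
  open import Data.Bool using (if_then_else_)
  open import Relation.Binary.PropositionalEquality
  open import Relation.Nullary using (¬?; Dec; does; yes; no)
  open FiniteSum
  open Enumeration
  open WeightCount
  open ≡-Reasoning

  column : ∀ {k n} → Mat k n → Word k → Fin n → ℤ
  column {k} G u j = sumℤ (map (λ i → + u i ℤ.* G i j) (allFin k))

  sumℤ-allFin : ∀ n (g : Fin n → ℤ) → sumℤ (map g (allFin n)) ≡ sumᶻ g
  sumℤ-allFin n g = trans (cong sumℤ (ListP.map-tabulate (λ i → i) g)) (sumℤ-tabulate n g)
    where
    sumℤ-tabulate : ∀ n (g : Fin n → ℤ) → sumℤ (tabulate g) ≡ sumᶻ g
    sumℤ-tabulate zero    g = refl
    sumℤ-tabulate (suc n) g = cong (ℤ._+_ (g zero)) (sumℤ-tabulate n (λ i → g (suc i)))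

  wt-allFin : ∀ n (h : Fin n → ℕ) → wt (map h (allFin n)) ≡ sum (λ j → 𝟙≢ (h j) 0)
  wt-allFin n h = trans (cong wt (ListP.map-tabulate (λ i → i) h)) (wt-tabulate n h)
    where
    wt-tabulate : ∀ n (h : Fin n → ℕ) → wt (tabulate h) ≡ sum (λ j → 𝟙≢ (h j) 0)
    wt-tabulate zero    h = refl
    wt-tabulate (suc n) h = by-cases (h zero ℕ.≟ 0)
      where
      nonzero? = λ a → ¬? (a ℕ.≟ 0)
      rest = sum (λ j → 𝟙≢ (h (suc j)) 0)
      by-cases : Dec (h zero ≡ 0) → wt (tabulate h) ≡ 𝟙≢ (h zero) 0 ℕ.+ rest
      by-cases (yes h₀≡0) = begin
        length (filter nonzero? (tabulate h))
          ≡⟨ cong length (ListP.filter-reject nonzero? (λ h₀≢0 → h₀≢0 h₀≡0)) ⟩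
        wt (tabulate (λ i → h (suc i)))
          ≡⟨ wt-tabulate n (λ i → h (suc i)) ⟩
        rest
          ≡⟨ cong (ℕ._+ rest) (trans (cong (λ a → 𝟙≢ a 0) h₀≡0) (𝟙≢-refl 0)) ⟨
        𝟙≢ (h zero) 0 ℕ.+ rest ∎
      by-cases (no h₀≢0) = begin
        length (filter nonzero? (tabulate h))
          ≡⟨ cong length (ListP.filter-accept nonzero? h₀≢0) ⟩
        suc (wt (tabulate (λ i → h (suc i))))
          ≡⟨ cong suc (wt-tabulate n (λ i → h (suc i))) ⟩
        1 ℕ.+ rest
          ≡⟨ cong (ℕ._+ rest) (𝟙≢-≢ h₀≢0) ⟨
        𝟙≢ (h zero) 0 ℕ.+ rest ∎

  sum-↑ : ∀ m n (F : Fin (m ℕ.+ n) → ℕ) → sum F ≡ sum (λ i → F (i ↑ˡ n)) ℕ.+ sum (λ i → F (m ↑ʳ i))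
  sum-↑ zero    n F = refl
  sum-↑ (suc m) n F = trans (cong (F zero ℕ.+_) (sum-↑ m n (λ i → F (suc i)))) (sym (ℕP.+-assoc (F zero) _ _))

  sumExcept : ∀ {k} → Word k → Fin k → ℕ
  sumExcept u j = sum (λ i → if does (i Fin.≟ j) then 0 else u i)

  sumExcept+u≡sum : ∀ k (u : Word k) j → sumExcept u j ℕ.+ u j ≡ sum u
  sumExcept+u≡sum (suc k) u zero    = ℕP.+-comm (sum (λ i → u (suc i))) (u zero)
  sumExcept+u≡sum (suc k) u (suc j) =
    trans (ℕP.+-assoc (u zero) _ (u (suc j))) (cong (u zero ℕ.+_) (sumExcept+u≡sum k (λ i → u (suc i)) j))

  sumᶻ-+ : ∀ k (u : Word k) → sumᶻ (λ i → + u i) ≡ + sum u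
  sumᶻ-+ zero    u = refl
  sumᶻ-+ (suc k) u = trans (cong (ℤ._+_ (+ u zero)) (sumᶻ-+ k (λ i → u (suc i)))) (sym (ℤP.pos-+ (u zero) _))

  module _ (k : ℕ) (u : Word k) where

    column-Ntil-↑ˡ : ∀ j → column (Ntil k) u (j ↑ˡ k) ≡ + u j
    column-Ntil-↑ˡ j = begin
      column (Ntil k) u (j ↑ˡ k)
        ≡⟨ sumℤ-allFin k _ ⟩
      sumᶻ (λ i → + u i ℤ.* Ntil k i (j ↑ˡ k))
        ≡⟨ sumᶻ-cong-≗ (λ i → cong (λ e → + u i ℤ.* e) (Ntil-↑ˡ i)) ⟩
      sumᶻ (λ i → + u i ℤ.* (if does (i Fin.≟ j) then + 1 else + 0))
        ≡⟨ pick k u j ⟩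
      + u j ∎
      where
      Ntil-↑ˡ : ∀ i → Ntil k i (j ↑ˡ k) ≡ (if does (i Fin.≟ j) then + 1 else + 0)
      Ntil-↑ˡ i rewrite FinP.splitAt-↑ˡ k j k = refl
      pick : ∀ k (u : Word k) j → sumᶻ (λ i → + u i ℤ.* (if does (i Fin.≟ j) then + 1 else + 0)) ≡ + u j
      pick (suc k) u zero    =
        trans (cong₂ ℤ._+_ (ℤP.*-identityʳ (+ u zero))
                           (trans (sumᶻ-cong-≗ (λ i → ℤP.*-zeroʳ (+ u (suc i)))) (sumᶻ-zero k)))
              (ℤP.+-identityʳ _)
      pick (suc k) u (suc j) =
        trans (cong₂ ℤ._+_ (ℤP.*-zeroʳ (+ u zero)) (pick k (λ i → u (suc i)) j)) (ℤP.+-identityˡ _)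

    column-Ntil-↑ʳ : ∀ j → column (Ntil k) u (k ↑ʳ j) ≡ + sumExcept u j
    column-Ntil-↑ʳ j = begin
      column (Ntil k) u (k ↑ʳ j)
        ≡⟨ sumℤ-allFin k _ ⟩
      sumᶻ (λ i → + u i ℤ.* Ntil k i (k ↑ʳ j))
        ≡⟨ sumᶻ-cong-≗ (λ i → cong (λ e → + u i ℤ.* e) (Ntil-↑ʳ i)) ⟩
      sumᶻ (λ i → + u i ℤ.* (if does (i Fin.≟ j) then + 0 else + 1))
        ≡⟨ skip k u j ⟩
      + sumExcept u j ∎
      where
      Ntil-↑ʳ : ∀ i → Ntil k i (k ↑ʳ j) ≡ (if does (i Fin.≟ j) then + 0 else + 1)
      Ntil-↑ʳ i rewrite FinP.splitAt-↑ʳ k k j = refl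
      skip : ∀ k (u : Word k) j → sumᶻ (λ i → + u i ℤ.* (if does (i Fin.≟ j) then + 0 else + 1)) ≡ + sumExcept u j
      skip (suc k) u zero    =
        trans (cong₂ ℤ._+_ (ℤP.*-zeroʳ (+ u zero))
                           (trans (sumᶻ-cong-≗ (λ i → ℤP.*-identityʳ (+ u (suc i)))) (sumᶻ-+ k (λ i → u (suc i)))))
              (ℤP.+-identityˡ _)
      skip (suc k) u (suc j) =
        trans (cong₂ ℤ._+_ (ℤP.*-identityʳ (+ u zero)) (skip k (λ i → u (suc i)) j)) (sym (ℤP.pos-+ (u zero) _))

    column-Ztil-↑ˡ : ∀ j → column (Ztil k) u (j ↑ˡ 1) ≡ column (Ntil k) u j
    column-Ztil-↑ˡ j = cong sumℤ (ListP.map-cong (λ i → cong (λ e → + u i ℤ.* e) (Ztil-↑ˡ i)) (allFin k))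
      where
      Ztil-↑ˡ : ∀ i → Ztil k i (j ↑ˡ 1) ≡ Ntil k i j
      Ztil-↑ˡ i rewrite FinP.splitAt-↑ˡ (k ℕ.+ k) j 1 = refl

    column-Ztil-last : column (Ztil k) u ((k ℕ.+ k) ↑ʳ zero) ≡ + sum u
    column-Ztil-last = begin
      column (Ztil k) u ((k ℕ.+ k) ↑ʳ zero)
        ≡⟨ sumℤ-allFin k _ ⟩
      sumᶻ (λ i → + u i ℤ.* Ztil k i ((k ℕ.+ k) ↑ʳ zero))
        ≡⟨ sumᶻ-cong-≗ (λ i → trans (cong (λ e → + u i ℤ.* e) (Ztil-last i)) (ℤP.*-identityʳ (+ u i))) ⟩
      sumᶻ (λ i → + u i)
        ≡⟨ sumᶻ-+ k u ⟩
      + sum u ∎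
      where
      Ztil-last : ∀ i → Ztil k i ((k ℕ.+ k) ↑ʳ zero) ≡ + 1
      Ztil-last i rewrite FinP.splitAt-↑ʳ (k ℕ.+ k) 1 zero = refl

  module _ (k q : ℕ) .{{_ : NonZero q}} where

    open Residue q using (+-cancelʳ-%)

    module _ (u : Word k) (u<q : Bounded q u) where

      private
        s = sum u % q
        entry = λ j → column (Ntil k) u j %ℕ q

      -- The right-hand entries of uÑ_k are s - u_j, which vanish exactly when u_j = s.
      𝟙≢-sumExcept : ∀ j → 𝟙≢ (sumExcept u j % q) 0 ≡ 𝟙≢ (u j) s
      𝟙≢-sumExcept j = 𝟙≢-cong ⇒ ⇐
        where
        r = sumExcept u j
        r+uⱼ≡sum = sumExcept+u≡sum k u j
        ⇒ : r % q ≡ 0 → u j ≡ s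
        ⇒ r%q≡0 = sym (begin
          sum u % q         ≡⟨ cong (_% q) r+uⱼ≡sum ⟨
          (r ℕ.+ u j) % q   ≡⟨ %-remove-+ˡ (u j) (m%n≡0⇒n∣m r q r%q≡0) ⟩
          u j % q           ≡⟨ m<n⇒m%n≡m (u<q j) ⟩
          u j               ∎)
        ⇐ : u j ≡ s → r % q ≡ 0
        ⇐ uⱼ≡s = trans (+-cancelʳ-% r 0 (u j) (begin
          (r ℕ.+ u j) % q   ≡⟨ cong (_% q) r+uⱼ≡sum ⟩
          s                 ≡⟨ uⱼ≡s ⟨
          u j               ≡⟨ m<n⇒m%n≡m (u<q j) ⟨
          u j % q           ∎)) (m*n%n≡0 0 q)

      sum-𝟙≢-entries : sum (λ j → 𝟙≢ (entry j) 0) ≡ weight s u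
      sum-𝟙≢-entries = begin
        sum (λ j → 𝟙≢ (entry j) 0)
          ≡⟨ sum-↑ k k _ ⟩
        sum (λ j → 𝟙≢ (entry (j ↑ˡ k)) 0) ℕ.+ sum (λ j → 𝟙≢ (entry (k ↑ʳ j)) 0)
          ≡⟨ cong₂ ℕ._+_ (sum-cong-≗ left) (sum-cong-≗ right) ⟩
        sum (λ j → 𝟙≢ (u j) 0) ℕ.+ sum (λ j → 𝟙≢ (u j) s)
          ≡⟨ ∑-distrib-+ (λ j → 𝟙≢ (u j) 0) (λ j → 𝟙≢ (u j) s) ⟨
        weight s u ∎
        where
        left : ∀ j → 𝟙≢ (entry (j ↑ˡ k)) 0 ≡ 𝟙≢ (u j) 0
        left j = cong (λ a → 𝟙≢ a 0) (trans (cong (_%ℕ q) (column-Ntil-↑ˡ k u j)) (m<n⇒m%n≡m (u<q j)))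
        right : ∀ j → 𝟙≢ (entry (k ↑ʳ j)) 0 ≡ 𝟙≢ (u j) s
        right j = trans (cong (λ a → 𝟙≢ (a %ℕ q) 0) (column-Ntil-↑ʳ k u j)) (𝟙≢-sumExcept j)

      wt-codeword-Ntil : wt (codeword (Ntil k) q u) ≡ weight s u
      wt-codeword-Ntil = trans (wt-allFin (k ℕ.+ k) entry) sum-𝟙≢-entries

      wt-codeword-Ztil : wt (codeword (Ztil k) q u) ≡ weight s u ℕ.+ 𝟙≢ s 0
      wt-codeword-Ztil = begin
        wt (codeword (Ztil k) q u)
          ≡⟨ wt-allFin ((k ℕ.+ k) ℕ.+ 1) entryZ ⟩
        sum (λ j → 𝟙≢ (entryZ j) 0)
          ≡⟨ sum-↑ (k ℕ.+ k) 1 _ ⟩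
        sum (λ j → 𝟙≢ (entryZ (j ↑ˡ 1)) 0) ℕ.+ (𝟙≢ (entryZ ((k ℕ.+ k) ↑ʳ zero)) 0 ℕ.+ 0)
          ≡⟨ cong₂ ℕ._+_ (trans (sum-cong-≗ (λ j → cong (λ c → 𝟙≢ (c %ℕ q) 0) (column-Ztil-↑ˡ k u j)))
                                sum-𝟙≢-entries)
                         (trans (ℕP.+-identityʳ _) (cong (λ c → 𝟙≢ (c %ℕ q) 0) (column-Ztil-last k u))) ⟩
        weight s u ℕ.+ 𝟙≢ s 0 ∎
        where
        entryZ = λ j → column (Ztil k) u j %ℕ q

    private
      tabulate-injective : ∀ {A : Set} n {f g : Fin n → A} → tabulate f ≡ tabulate g → ∀ j → f j ≡ g j
      tabulate-injective (suc n) eq zero    = ListP.∷-injectiveˡ eq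
      tabulate-injective (suc n) eq (suc j) = tabulate-injective n (ListP.∷-injectiveʳ eq) j

      entries≡ : ∀ {n} (G : Mat k n) {u v} → codeword G q u ≡ codeword G q v →
                 ∀ j → column G u j %ℕ q ≡ column G v j %ℕ q
      entries≡ {n} G eq = tabulate-injective n
        (trans (sym (ListP.map-tabulate (λ i → i) _)) (trans eq (ListP.map-tabulate (λ i → i) _)))

      codeword-Ntil-≡ : ∀ {u v} → codeword (Ntil k) q u ≡ codeword (Ntil k) q v → ∀ i → u i % q ≡ v i % q
      codeword-Ntil-≡ {u} {v} eq i = begin
        u i % q                              ≡⟨ cong (_%ℕ q) (column-Ntil-↑ˡ k u i) ⟨
        column (Ntil k) u (i ↑ˡ k) %ℕ q      ≡⟨ entries≡ (Ntil k) {u} {v} eq (i ↑ˡ k) ⟩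
        column (Ntil k) v (i ↑ˡ k) %ℕ q      ≡⟨ cong (_%ℕ q) (column-Ntil-↑ˡ k v i) ⟩
        v i % q                              ∎

      codeword-Ztil-≡ : ∀ {u v} → codeword (Ztil k) q u ≡ codeword (Ztil k) q v → ∀ i → u i % q ≡ v i % q
      codeword-Ztil-≡ {u} {v} eq i = begin
        u i % q                                     ≡⟨ cong (_%ℕ q) (column-Ntil-↑ˡ k u i) ⟨
        column (Ntil k) u (i ↑ˡ k) %ℕ q             ≡⟨ cong (_%ℕ q) (column-Ztil-↑ˡ k u (i ↑ˡ k)) ⟨
        column (Ztil k) u ((i ↑ˡ k) ↑ˡ 1) %ℕ q      ≡⟨ entries≡ (Ztil k) {u} {v} eq ((i ↑ˡ k) ↑ˡ 1) ⟩
        column (Ztil k) v ((i ↑ˡ k) ↑ˡ 1) %ℕ q      ≡⟨ cong (_%ℕ q) (column-Ztil-↑ˡ k v (i ↑ˡ k)) ⟩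
        column (Ntil k) v (i ↑ˡ k) %ℕ q             ≡⟨ cong (_%ℕ q) (column-Ntil-↑ˡ k v i) ⟩
        v i % q                                     ∎

    codewords-distinct-Ntil : AllPairs _≢_ (map (codeword (Ntil k) q) (allVecs k q))
    codewords-distinct-Ntil =
      AllPairsP.map⁺ (AllPairs.map (λ u≉v u≡v → u≉v (codeword-Ntil-≡ u≡v)) (allVecs-distinct k q))

    codewords-distinct-Ztil : AllPairs _≢_ (map (codeword (Ztil k) q) (allVecs k q))
    codewords-distinct-Ztil =
      AllPairsP.map⁺ (AllPairs.map (λ u≉v u≡v → u≉v (codeword-Ztil-≡ u≡v)) (allVecs-distinct k q))

  W≡∑ : ∀ {k n} (G : Mat k n) q′ (weightG : Word k → ℕ) →
        AllPairs _≢_ (map (codeword G (suc q′)) (allVecs k (suc q′))) →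
        (∀ u → Bounded (suc q′) u → wt (codeword G (suc q′) u) ≡ weightG u) →
        ∀ i j → W G (suc q′) i j ≡
                (if does (i ℕ.+ j ℕ.≟ n) then ∑[ u ∈ allVecs k (suc q′) ] 𝟙 (weightG u ℕ.≟ j) else + 0)
  W≡∑ {k} {n} G q′ weightG distinct wt≡ i j = cong (λ c → if does (i ℕ.+ j ℕ.≟ n) then c else + 0) (begin
    + length (filter (λ c → wt c ℕ.≟ j) (code G q))
      ≡⟨ cong (λ cs → + length (filter (λ c → wt c ℕ.≟ j) cs))
              (deduplicate-distinct (ListP.≡-dec ℕ._≟_) _ distinct) ⟩
    + length (filter (λ c → wt c ℕ.≟ j) (map (codeword G q) vs))
      ≡⟨ length-filter≡∑𝟙 (λ c → wt c ℕ.≟ j) (map (codeword G q) vs) ⟩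
    ∑[ c ∈ map (codeword G q) vs ] 𝟙 (wt c ℕ.≟ j)
      ≡⟨ ∑ᴸ-map (codeword G q) vs _ ⟩
    ∑[ u ∈ vs ] 𝟙 (wt (codeword G q u) ℕ.≟ j)
      ≡⟨ ∑ᴸ-cong-All (allVecs-bounded k q) (λ u u<q → cong (λ w → 𝟙 (w ℕ.≟ j)) (wt≡ u u<q)) ⟩
    ∑[ u ∈ vs ] 𝟙 (weightG u ℕ.≟ j) ∎)
    where
    q = suc q′
    vs = allVecs k q

  W-Ntil : ∀ k q′ i j → W (Ntil k) (suc q′) i j ≡
                        (if does (i ℕ.+ j ℕ.≟ k ℕ.+ k) then closedCount k (+ j) (+ j) (suc q′) else + 0)
  W-Ntil k q′ i j = trans (W≡∑ (Ntil k) q′ _ (codewords-distinct-Ntil k (suc q′)) (wt-codeword-Ntil k (suc q′)) i j)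
    (cong (λ c → if does (i ℕ.+ j ℕ.≟ k ℕ.+ k) then c else + 0) (∑-weight≡closedCount k q′ j))

  W-Ztil : ∀ k q′ i j → W (Ztil k) (suc q′) i j ≡
                        (if does (i ℕ.+ j ℕ.≟ (k ℕ.+ k) ℕ.+ 1) then closedCount k (+ j) (+ j ℤ.- + 1) (suc q′) else + 0)
  W-Ztil k q′ i j = trans (W≡∑ (Ztil k) q′ _ (codewords-distinct-Ztil k (suc q′)) (wt-codeword-Ztil k (suc q′)) i j)
    (cong (λ c → if does (i ℕ.+ j ℕ.≟ (k ℕ.+ k) ℕ.+ 1) then c else + 0) (∑-weight+𝟙≢≡closedCount k q′ j))

module FixedPoints where

  open import Data.Nat as ℕ using (ℕ; zero; suc; _<_; NonZero; _*_)
  import Data.Nat.Properties as ℕP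
  open import Data.Nat.DivMod
  open import Data.Nat.Divisibility
  open import Data.Nat.GCD
  open import Data.Nat.Coprimality using (GCD≡1⇒coprime; coprime-divisor)
  import Data.Nat.Coprimality as Coprimality
  open import Data.Integer as ℤ using (+_)
  open import Data.Product using (_×_; _,_)
  open import Data.Sum using (inj₂)
  open import Relation.Binary.PropositionalEquality
  open FiniteSum
  open WeightCount using (fixedCount)
  open import Data.Integer.Solver using (module +-*-Solver)
  open +-*-Solver
  open ≡-Reasoning

  ∑-multiples : ∀ g q .{{_ : NonZero q}} → ∑[ s < g * q ] 𝟙 (s % q ℕ.≟ 0) ≡ + g
  ∑-multiples zero    q = refl
  ∑-multiples (suc g) q = begin
    ∑ (q ℕ.+ g * q) f
      ≡⟨ ∑-split q (g * q) f ⟩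
    ∑ q f ℤ.+ ∑[ s < g * q ] f (q ℕ.+ s)
      ≡⟨ cong₂ ℤ._+_ first-block (trans (∑-cong′ (g * q) shift) (∑-multiples g q)) ⟩
    + 1 ℤ.+ + g ∎
    where
    f = λ s → 𝟙 (s % q ℕ.≟ 0)
    first-block : ∑ q f ≡ + 1
    first-block = trans (∑-cong q (λ s s<q → 𝟙-cong (trans (sym (m<n⇒m%n≡m s<q))) (trans (m<n⇒m%n≡m s<q))))
                        (∑-𝟙 q 0 (ℕ.>-nonZero⁻¹ q))
    shift : ∀ s → f (q ℕ.+ s) ≡ f s
    shift s = cong (λ r → 𝟙 (r ℕ.≟ 0)) (trans (cong (_% q) (ℕP.+-comm q s)) ([m+n]%n≡m%n s q))

  module _ (d q : ℕ) .{{_ : NonZero q}} where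

    open Residue q using (+-cancelʳ-%)

    [1+d]s%q≡s⇒q∣ds : ∀ {s} → s < q → (suc d * s) % q ≡ s → q ∣ d * s
    [1+d]s%q≡s⇒q∣ds {s} s<q eq = m%n≡0⇒n∣m (d * s) q (trans (+-cancelʳ-% (d * s) 0 s ds+s≡0+s) (m*n%n≡0 0 q))
      where
      ds+s≡0+s : (d * s ℕ.+ s) % q ≡ (0 ℕ.+ s) % q
      ds+s≡0+s = trans (cong (_% q) (ℕP.+-comm (d * s) s)) (trans eq (sym (m<n⇒m%n≡m s<q)))

    q∣ds⇒[1+d]s%q≡s : ∀ {s} → s < q → q ∣ d * s → (suc d * s) % q ≡ s
    q∣ds⇒[1+d]s%q≡s {s} s<q q∣ds = trans (%-remove-+ʳ s q∣ds) (m<n⇒m%n≡m s<q)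

    private
      g = gcd d q
      instance
        g≢0 : NonZero g
        g≢0 = ℕ.≢-nonZero (gcd[m,n]≢0 d q (inj₂ (ℕ.≢-nonZero⁻¹ q)))
      q′ = q / g
      d′ = d / g
      q′*g≡q : q′ * g ≡ q
      q′*g≡q = m/n*n≡m (gcd[m,n]∣n d q)
      instance
        q′≢0 : NonZero q′
        q′≢0 = ℕ.≢-nonZero (λ q′≡0 → ℕ.≢-nonZero⁻¹ q (trans (sym q′*g≡q) (cong (_* g) q′≡0)))

      -- q ∣ d s iff q / g ∣ s, since q / g and d / g are coprime.
      q∣ds⇒q′∣s : ∀ s → q ∣ d * s → q′ ∣ s
      q∣ds⇒q′∣s s q∣ds = coprime-divisor (Coprimality.sym (GCD≡1⇒coprime (GCD-/gcd d q)))
                                         (*-cancelʳ-∣ g (subst₂ _∣_ (sym q′*g≡q) ds≡d′sg q∣ds))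
        where
        ds≡d′sg : d * s ≡ d′ * s * g
        ds≡d′sg = begin
          d * s           ≡⟨ cong (_* s) (m/n*n≡m (gcd[m,n]∣m d q)) ⟨
          d′ * g * s      ≡⟨ ℕP.*-assoc d′ g s ⟩
          d′ * (g * s)    ≡⟨ cong (d′ *_) (ℕP.*-comm g s) ⟩
          d′ * (s * g)    ≡⟨ ℕP.*-assoc d′ s g ⟨
          d′ * s * g      ∎

      q′∣s⇒q∣ds : ∀ s → q′ ∣ s → q ∣ d * s
      q′∣s⇒q∣ds s q′∣s = subst₂ _∣_ q′*g≡q (ℕP.*-comm s d) (*-pres-∣ q′∣s (gcd[m,n]∣m d q))

    ∑-fixed≡gcd : ∑[ s < q ] 𝟙 (s ℕ.≟ (suc d * s) % q) ≡ + gcd d q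
    ∑-fixed≡gcd = begin
      ∑[ s < q ] 𝟙 (s ℕ.≟ (suc d * s) % q)
        ≡⟨ ∑-cong q (λ s s<q → fixed⇔multiple s s<q) ⟩
      ∑[ s < q ] 𝟙 (s % q′ ℕ.≟ 0)
        ≡⟨ cong (λ n → ∑[ s < n ] 𝟙 (s % q′ ℕ.≟ 0)) (trans (sym q′*g≡q) (ℕP.*-comm q′ g)) ⟩
      ∑[ s < g * q′ ] 𝟙 (s % q′ ℕ.≟ 0)
        ≡⟨ ∑-multiples g q′ ⟩
      + g ∎
      where
      fixed⇔multiple : ∀ s → s < q → 𝟙 (s ℕ.≟ (suc d * s) % q) ≡ 𝟙 (s % q′ ℕ.≟ 0)
      fixed⇔multiple s s<q =
        𝟙-cong (λ s≡ → n∣m⇒m%n≡0 s q′ (q∣ds⇒q′∣s s ([1+d]s%q≡s⇒q∣ds s<q (sym s≡))))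
               (λ s%q′≡0 → sym (q∣ds⇒[1+d]s%q≡s s<q (q′∣s⇒q∣ds s (m%n≡0⇒n∣m s q′ s%q′≡0))))

  fixedCount-suc : ∀ q′ d → fixedCount q′ (suc d) ≡ + gcd d (suc q′) ℤ.- + 1
  fixedCount-suc q′ d = begin
    fixedCount q′ (suc d)
      ≡⟨ solve 1 (λ x → x := (con (+ 1) :+ x) :- con (+ 1)) refl (fixedCount q′ (suc d)) ⟩
    (+ 1 ℤ.+ fixedCount q′ (suc d)) ℤ.- + 1
      ≡⟨ cong (λ x → (x ℤ.+ fixedCount q′ (suc d)) ℤ.- + 1) (𝟙-yes (0 ℕ.≟ (suc d * 0) % suc q′) (sym 0≡)) ⟨
    (𝟙 (0 ℕ.≟ (suc d * 0) % suc q′) ℤ.+ fixedCount q′ (suc d)) ℤ.- + 1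
      ≡⟨ cong (ℤ._- + 1) (∑-fixed≡gcd d (suc q′)) ⟩
    + gcd d (suc q′) ℤ.- + 1 ∎
    where
    0≡ : (suc d * 0) % suc q′ ≡ 0
    0≡ = cong (_% suc q′) (ℕP.*-zeroʳ (suc d))

  fixedCount-pred : ∀ {q} d → 1 ℕ.≤ q → fixedCount (ℕ.pred q) (suc d) ≡ + gcd d q ℤ.- + 1
  fixedCount-pred {suc q′} d _ = fixedCount-suc q′ d

  fixedCount-1 : ∀ q′ → fixedCount q′ 1 ≡ + suc q′ ℤ.- + 1
  fixedCount-1 q′ = trans (fixedCount-suc q′ 0) (cong (λ g → + g ℤ.- + 1) (gcd-identityˡ (suc q′)))

  fixedCount-0 : ∀ q′ → fixedCount q′ 0 ≡ + 0
  fixedCount-0 q′ = ∑-zero q′ (λ s _ → 𝟙-no (suc s ℕ.≟ 0) λ ())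

  gcd-periodic : ∀ d m ρ t → d ∣ ρ → gcd d (m ℕ.+ t * ρ) ≡ gcd d m
  gcd-periodic d m ρ t d∣ρ = sym (gcd-universality ⇒ ⇐)
    where
    ⇒ : ∀ {c} → c ∣ d × c ∣ (m ℕ.+ t * ρ) → c ∣ gcd d m
    ⇒ {c} (c∣d , c∣m+tρ) =
      gcd-greatest c∣d (∣m+n∣m⇒∣n (subst (c ∣_) (ℕP.+-comm m (t * ρ)) c∣m+tρ) (∣n⇒∣m*n t (∣-trans c∣d d∣ρ)))
    ⇐ : ∀ {c} → c ∣ gcd d m → c ∣ d × c ∣ (m ℕ.+ t * ρ)
    ⇐ c∣g = ∣-trans c∣g (gcd[m,n]∣m d m) ,
            ∣m∣n⇒∣m+n (∣-trans c∣g (gcd[m,n]∣n d m)) (∣n⇒∣m*n t (∣-trans (∣-trans c∣g (gcd[m,n]∣m d m)) d∣ρ))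

module QuasiPolynomial where

  open import Defs
  open import Data.Nat as ℕ using (ℕ; zero; suc; _<_; _≤_; z≤n; s≤s; _∸_)
  import Data.Nat.Properties as ℕP
  open import Data.Nat.Divisibility using (_∣_; ∣-trans; divides)
  open import Data.Nat.LCM using (m∣lcm[m,n]; n∣lcm[m,n]; lcm-least; gcd*lcm)
  open import Data.Nat.GCD using (gcd)
  open import Data.Integer using (ℤ; +_; _+_; _*_; -_; _-_)
  import Data.Rational as ℚ
  open import Data.List using ([])
  open import Data.Bool using (true; false; if_then_else_)
  open import Data.Product using (Σ; _,_)
  open import Relation.Binary.PropositionalEquality
  open import Relation.Nullary using (does; yes; no)
  open import Data.Empty using (⊥-elim)
  open RationalPolynomial
  open ToℚHomomorphism
  open FiniteSum
  open WeightCount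
  open FixedPoints
  open CodeWeight using (W-Ntil; W-Ztil)

  record PolynomialOn (P : ℕ → Set) (F : ℕ → ℤ) : Set where
    constructor _,_
    field
      poly   : Poly
      agrees : ∀ q → P q → evalT poly (toℚ (+ q)) ≡ toℚ (F q)
  open PolynomialOn public

  module _ {P : ℕ → Set} where

    infixl 6 _+ᴾ_ _-ᴾ_
    infixl 7 _*ᴾ_

    constᴾ : ∀ c → PolynomialOn P (λ _ → c)
    constᴾ c = constₚ (toℚ c) , λ q _ → evalT-constₚ (toℚ c) (toℚ (+ q))

    varᴾ : PolynomialOn P (λ q → + q)
    varᴾ = varₚ , λ q _ → evalT-varₚ (toℚ (+ q))

    _+ᴾ_ : ∀ {F G} → PolynomialOn P F → PolynomialOn P G → PolynomialOn P (λ q → F q + G q)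
    _+ᴾ_ {F} {G} (p , p≈F) (r , r≈G) = p +ₚ r , λ q Pq →
      trans (evalT-+ₚ p r (toℚ (+ q))) (trans (cong₂ ℚ._+_ (p≈F q Pq) (r≈G q Pq)) (sym (toℚ-+ (F q) (G q))))

    _*ᴾ_ : ∀ {F G} → PolynomialOn P F → PolynomialOn P G → PolynomialOn P (λ q → F q * G q)
    _*ᴾ_ {F} {G} (p , p≈F) (r , r≈G) = p *ₚ r , λ q Pq →
      trans (evalT-*ₚ p r (toℚ (+ q))) (trans (cong₂ ℚ._*_ (p≈F q Pq) (r≈G q Pq)) (sym (toℚ-* (F q) (G q))))

    -ᴾ_ : ∀ {F} → PolynomialOn P F → PolynomialOn P (λ q → - F q)
    -ᴾ_ {F} (p , p≈F) = -ₚ p , λ q Pq →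
      trans (evalT--ₚ p (toℚ (+ q))) (trans (cong ℚ.-_ (p≈F q Pq)) (sym (toℚ-neg (F q))))

    _-ᴾ_ : ∀ {F G} → PolynomialOn P F → PolynomialOn P G → PolynomialOn P (λ q → F q - G q)
    pF -ᴾ pG = pF +ᴾ (-ᴾ pG)

    congᴾ : ∀ {F G} → (∀ q → P q → F q ≡ G q) → PolynomialOn P F → PolynomialOn P G
    congᴾ F≡G (p , p≈F) = p , λ q Pq → trans (p≈F q Pq) (cong toℚ (F≡G q Pq))

    ∑ᴾ : ∀ n {F : ℕ → ℕ → ℤ} → (∀ i → i < n → PolynomialOn P (F i)) → PolynomialOn P (λ q → ∑[ i < n ] F i q)
    ∑ᴾ zero    _    = constᴾ (+ 0)
    ∑ᴾ (suc n) pFᵢ = pFᵢ 0 (s≤s z≤n) +ᴾ ∑ᴾ n (λ i i<n → pFᵢ (suc i) (s≤s i<n))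

    βᴾ : ∀ k w → PolynomialOn P (λ q → β k q w)
    βᴾ zero    w = constᴾ (+ 0)
    βᴾ (suc k) w = constᴾ (+ 2) *ᴾ βᴾ k (w - + 1) +ᴾ (varᴾ *ᴾ βᴾ k (w - + 2) +ᴾ constᴾ (∑α k (w - + 2)))
                   -ᴾ constᴾ (+ 2) *ᴾ βᴾ k (w - + 2)

    β₀ᴾ : ∀ k w → PolynomialOn P (λ q → β₀ k q w)
    β₀ᴾ zero    w = constᴾ (+ 0)
    β₀ᴾ (suc k) w = β₀ᴾ k w +ᴾ (varᴾ *ᴾ β₀ᴾ k (w - + 2) +ᴾ constᴾ (α₀ k (w - + 2))) -ᴾ β₀ᴾ k (w - + 2)

  lcmUpTo≢0 : ∀ n → lcmUpTo n ≢ 0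
  lcmUpTo≢0 zero    ()
  lcmUpTo≢0 (suc n) lcm≡0 = lcmUpTo≢0 n (ℕP.m*n≡0⇒m≡0 (lcmUpTo n) (suc n) (begin
    lcmUpTo n ℕ.* suc n                               ≡⟨ ℕP.*-comm (lcmUpTo n) (suc n) ⟩
    suc n ℕ.* lcmUpTo n                               ≡⟨ gcd*lcm (suc n) (lcmUpTo n) ⟨
    gcd (suc n) (lcmUpTo n) ℕ.* lcmUpTo (suc n)       ≡⟨ cong (gcd (suc n) (lcmUpTo n) ℕ.*_) lcm≡0 ⟩
    gcd (suc n) (lcmUpTo n) ℕ.* 0                     ≡⟨ ℕP.*-zeroʳ (gcd (suc n) (lcmUpTo n)) ⟩
    0                                                 ∎))
    where open ≡-Reasoning

  1≤lcmUpTo : ∀ n → 1 ≤ lcmUpTo n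
  1≤lcmUpTo n = ℕP.n≢0⇒n>0 (lcmUpTo≢0 n)

  ∣lcmUpTo : ∀ n d → 1 ≤ d → d ≤ n → d ∣ lcmUpTo n
  ∣lcmUpTo zero    d 1≤d d≤0 = ⊥-elim (ℕP.<⇒≱ 1≤d d≤0)
  ∣lcmUpTo (suc n) d 1≤d d≤1+n with d ℕP.≟ suc n
  ... | yes refl = m∣lcm[m,n] (suc n) (lcmUpTo n)
  ... | no  d≢1+n =
    ∣-trans (∣lcmUpTo n d 1≤d (ℕP.≤-pred (ℕP.≤∧≢⇒< d≤1+n d≢1+n))) (n∣lcm[m,n] (suc n) (lcmUpTo n))

  lcmUpTo-least : ∀ n c → (∀ d → 1 ≤ d → d ≤ n → d ∣ c) → lcmUpTo n ∣ c
  lcmUpTo-least zero    c _     = divides c (sym (ℕP.*-identityʳ c))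
  lcmUpTo-least (suc n) c d∣c = lcm-least (d∣c (suc n) (s≤s z≤n) ℕP.≤-refl)
                                          (lcmUpTo-least n c (λ d 1≤d d≤n → d∣c d 1≤d (ℕP.m≤n⇒m≤1+n d≤n)))

  Positive : ℕ → Set
  Positive q = 1 ≤ q

  _≡_[mod_] : ℕ → ℕ → ℕ → Set
  q ≡ m [mod ρ ] = Σ ℕ (λ t → q ≡ m ℕ.+ t ℕ.* ρ)

  weakenᴾ : ∀ {P Q : ℕ → Set} {F} → (∀ q → P q → Q q) → PolynomialOn Q F → PolynomialOn P F
  weakenᴾ P⇒Q (p , p≈F) = p , λ q Pq → p≈F q (P⇒Q q Pq)

  fixedCount₀ᴾ : PolynomialOn Positive (λ q → fixedCount (ℕ.pred q) 0)
  fixedCount₀ᴾ = congᴾ (λ { (suc q′) _ → sym (fixedCount-0 q′) }) (constᴾ (+ 0))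

  fixedCount₁ᴾ : PolynomialOn Positive (λ q → fixedCount (ℕ.pred q) 1)
  fixedCount₁ᴾ = congᴾ (λ { (suc q′) _ → sym (fixedCount-1 q′) }) (varᴾ -ᴾ constᴾ (+ 1))

  module _ (k m : ℕ) (1≤m : 1 ≤ m) where

    private
      positive : ∀ q → q ≡ m [mod lcmUpTo (k ∸ 1) ] → Positive q
      positive q (t , refl) = ℕP.≤-trans 1≤m (ℕP.m≤m+n m _)

    -- For 2 ≤ i ≤ k, fixedCount is gcd(i - 1, q) - 1, and i - 1 divides the period ρ.
    fixedCountᴾ : ∀ i → i < suc k →
                  PolynomialOn (_≡ m [mod lcmUpTo (k ∸ 1) ]) (λ q → fixedCount (ℕ.pred q) i)
    fixedCountᴾ zero          _         = weakenᴾ positive fixedCount₀ᴾ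
    fixedCountᴾ (suc zero)    _         = weakenᴾ positive fixedCount₁ᴾ
    fixedCountᴾ (suc (suc d)) (s≤s i≤k) = congᴾ periodic (constᴾ (+ gcd (suc d) m - + 1))
      where
      ρ = lcmUpTo (k ∸ 1)
      d+1∣ρ : suc d ∣ ρ
      d+1∣ρ = ∣lcmUpTo (k ∸ 1) (suc d) (s≤s z≤n) (ℕP.∸-monoˡ-≤ 1 i≤k)
      periodic : ∀ q → q ≡ m [mod ρ ] → + gcd (suc d) m - + 1 ≡ fixedCount (ℕ.pred q) (suc (suc d))
      periodic q q≡m@(t , refl) = sym (trans (fixedCount-pred (suc d) (positive q q≡m))
                                            (cong (λ g → + g - + 1) (gcd-periodic (suc d) m ρ t d+1∣ρ)))

    closedCountᴾ : ∀ w₀ w₁ → PolynomialOn (_≡ m [mod lcmUpTo (k ∸ 1) ]) (closedCount k w₀ w₁)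
    closedCountᴾ w₀ w₁ = β₀ᴾ k w₀ +ᴾ constᴾ (α₀ k w₀) +ᴾ (varᴾ -ᴾ constᴾ (+ 1)) *ᴾ βᴾ k w₁
                         +ᴾ ∑ᴾ (suc k) (λ i i≤k → constᴾ (α k i w₁) *ᴾ fixedCountᴾ i i≤k)

  private
    evalT-if : ∀ b p c x → evalT p x ≡ toℚ c → evalT (if b then p else []) x ≡ toℚ (if b then c else + 0)
    evalT-if true  p c x eq = eq
    evalT-if false p c x eq = refl

  closedCount⇒quasiPolynomial : ∀ k (F : ℕ → Polyℤxy) n (w₁ : ℕ → ℤ) →
    (∀ q′ i j → F (suc q′) i j ≡ (if does (i ℕ.+ j ℕ.≟ n) then closedCount k (+ j) (w₁ j) (suc q′) else + 0)) →
    IsQuasiPolyWithPeriod F (lcmUpTo (k ∸ 1))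
  closedCount⇒quasiPolynomial k F n w₁ F≡ = 1≤lcmUpTo (k ∸ 1) , f , f≈F
    where
    ρ = lcmUpTo (k ∸ 1)
    P : ∀ m′ j → PolynomialOn (_≡ suc m′ [mod ρ ]) (closedCount k (+ j) (w₁ j))
    P m′ j = closedCountᴾ k (suc m′) (s≤s z≤n) (+ j) (w₁ j)
    f : ℕ → PolyℚxyT
    f zero     i j = []
    f (suc m′) i j = if does (i ℕ.+ j ℕ.≟ n) then poly (P m′ j) else []
    f≈F : ∀ m t → 1 ≤ m → m ≤ ρ → ∀ i j →
          evalT (f m i j) (toℚ (+ (m ℕ.+ t ℕ.* ρ))) ≡ toℚ (F (m ℕ.+ t ℕ.* ρ) i j)
    f≈F (suc m′) t _ _ i j = trans
      (evalT-if (does (i ℕ.+ j ℕ.≟ n)) (poly (P m′ j)) (closedCount k (+ j) (w₁ j) q) (toℚ (+ q))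
                (agrees (P m′ j) q (t , refl)))
      (cong toℚ (sym (F≡ (m′ ℕ.+ t ℕ.* ρ) i j)))
      where q = suc m′ ℕ.+ t ℕ.* ρ

  W-Ntil-quasiPolynomial : ∀ k → IsQuasiPolyWithPeriod (W (Ntil k)) (lcmUpTo (k ∸ 1))
  W-Ntil-quasiPolynomial k = closedCount⇒quasiPolynomial k (W (Ntil k)) (k ℕ.+ k) (λ j → + j) (W-Ntil k)

  W-Ztil-quasiPolynomial : ∀ k → IsQuasiPolyWithPeriod (W (Ztil k)) (lcmUpTo (k ∸ 1))
  W-Ztil-quasiPolynomial k =
    closedCount⇒quasiPolynomial k (W (Ztil k)) ((k ℕ.+ k) ℕ.+ 1) (λ j → + j - + 1) (W-Ztil k)

module LowerBound where

  open import Defs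
  open import Data.Nat as ℕ using (ℕ; zero; suc; _<_; _≤_; z≤n; s≤s; _∸_)
  import Data.Nat.Properties as ℕP
  open import Data.Nat.Combinatorics using (_C_; nCk+nC[k+1]≡[n+1]C[k+1])
  open import Data.Nat.Divisibility using (_∣_; ∣⇒≤; ∣-antisym; ∣-refl)
  open import Data.Nat.GCD using (gcd; gcd[m,n]∣m; gcd[m,n]∣n; gcd-greatest)
  open import Data.Integer as ℤ using (ℤ; +_; _+_; _*_; -_; _-_; +≤+)
  import Data.Integer.Properties as ℤP
  open import Data.Integer.Solver using (module +-*-Solver)
  open import Data.Rational as ℚ using (ℚ; 0ℚ)
  import Data.Rational.Properties as ℚP
  import Data.Rational.Solver as ℚSolver
  open import Data.List using (length)
  open import Data.Product using (_,_; proj₁)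
  open import Data.Bool using (if_then_else_)
  open import Relation.Binary.PropositionalEquality
  open import Relation.Nullary using (does)
  open import Relation.Nullary.Decidable using (dec-true)
  open RationalPolynomial
  open ToℚHomomorphism
  open FiniteSum
  open WeightCount
  open FixedPoints
  open QuasiPolynomial
  open CodeWeight using (W-Ntil; W-Ztil)
  open +-*-Solver using (solve; _:=_; _:+_; _:-_; con)
  open ≡-Reasoning

  0<nCk : ∀ n k → k ≤ n → 0 < n C k
  0<nCk n       zero    _         = s≤s z≤n
  0<nCk (suc n) (suc k) (s≤s k≤n) = ℕP.<-≤-trans (0<nCk n k k≤n)
    (ℕP.≤-trans (ℕP.m≤m+n (n C k) (n C suc k)) (ℕP.≤-reflexive (nCk+nC[k+1]≡[n+1]C[k+1] n k)))

  private
    [1+k]-1≡k : ∀ k → + suc k - + 1 ≡ + k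
    [1+k]-1≡k k = solve 1 (λ k → (con (+ 1) :+ k) :- con (+ 1) := k) refl (+ k)

    [1+k]-2≡k-1 : ∀ k → + suc k - + 2 ≡ + k - + 1
    [1+k]-2≡k-1 k = solve 1 (λ k → (con (+ 1) :+ k) :- con (+ 2) := k :- con (+ 1)) refl (+ k)

    x-1≡y-1⇒x≡y : ∀ {x y} → x - + 1 ≡ y - + 1 → x ≡ y
    x-1≡y-1⇒x≡y {x} {y} eq = begin
      x                 ≡⟨ solve 1 (λ x → x := (x :- con (+ 1)) :+ con (+ 1)) refl x ⟩
      (x - + 1) + + 1   ≡⟨ cong (_+ + 1) eq ⟩
      (y - + 1) + + 1   ≡⟨ solve 1 (λ y → (y :- con (+ 1)) :+ con (+ 1) := y) refl y ⟩
      y                 ∎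

  mul1+X-cong : ∀ {a b} → (∀ j → a j ≡ b j) → ∀ i → mul1+X a i ≡ mul1+X b i
  mul1+X-cong a≡b zero    = a≡b zero
  mul1+X-cong a≡b (suc i) = cong₂ _+_ (a≡b (suc i)) (a≡b i)

  mul1+X-zero : ∀ {a} → (∀ j → a j ≡ + 0) → ∀ i → mul1+X a i ≡ + 0
  mul1+X-zero a≡0 zero    = a≡0 zero
  mul1+X-zero a≡0 (suc i) = mul1+X-cong a≡0 (suc i)

  mul1+X-binomial : ∀ n j → mul1+X (λ i → + (n C i)) j ≡ + (suc n C j)
  mul1+X-binomial n zero    = refl
  mul1+X-binomial n (suc j) = cong (λ m → + m) (trans (ℕP.+-comm (n C suc j) (n C j)) (nCk+nC[k+1]≡[n+1]C[k+1] n j))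

  α-below-diagonal : ∀ k i n → α k i (+ k - + suc n) ≡ + 0
  α-below-diagonal zero    i n =
    trans (cong (𝟙 (i ℕ.≟ 0) *_) (𝟙-no (ℤ.-[1+ n ] ℤ.≟ + 0) λ ())) (ℤP.*-zeroʳ (𝟙 (i ℕ.≟ 0)))
  α-below-diagonal (suc k) i n = mul1+X-zero Δ≡0 i
    where
    [1+k-1-n]-1≡k-[1+n] : (+ suc k - + suc n) - + 1 ≡ + k - + suc n
    [1+k-1-n]-1≡k-[1+n] =
      solve 2 (λ k n → ((con (+ 1) :+ k) :- (con (+ 1) :+ n)) :- con (+ 1) := k :- (con (+ 1) :+ n)) refl (+ k) (+ n)
    [1+k-1-n]-2≡k-[2+n] : (+ suc k - + suc n) - + 2 ≡ + k - + suc (suc n)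
    [1+k-1-n]-2≡k-[2+n] =
      solve 2 (λ k n → ((con (+ 1) :+ k) :- (con (+ 1) :+ n)) :- con (+ 2) := k :- (con (+ 2) :+ n)) refl (+ k) (+ n)
    Δ≡0 : ∀ j → α k j ((+ suc k - + suc n) - + 1) - α k j ((+ suc k - + suc n) - + 2) ≡ + 0
    Δ≡0 j = trans (cong₂ (λ x y → α k j x - α k j y) [1+k-1-n]-1≡k-[1+n] [1+k-1-n]-2≡k-[2+n])
                  (cong₂ _-_ (α-below-diagonal k j n) (α-below-diagonal k j (suc n)))

  α-diagonal : ∀ k j → α k j (+ k) ≡ + (k C j)
  α-diagonal zero    zero    = cong₂ _*_ (𝟙-yes (0 ℕ.≟ 0) refl) (𝟙-yes (+ 0 ℤ.≟ + 0) refl)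
  α-diagonal zero    (suc j) =
    trans (cong (_* 𝟙 (+ 0 ℤ.≟ + 0)) (𝟙-no (suc j ℕ.≟ 0) λ ())) (ℤP.*-zeroˡ (𝟙 (+ 0 ℤ.≟ + 0)))
  α-diagonal (suc k) j       = trans (mul1+X-cong Δ≡binomial j) (mul1+X-binomial k j)
    where
    Δ≡binomial : ∀ j → α k j (+ suc k - + 1) - α k j (+ suc k - + 2) ≡ + (k C j)
    Δ≡binomial j = begin
      α k j (+ suc k - + 1) - α k j (+ suc k - + 2)
        ≡⟨ cong₂ (λ x y → α k j x - α k j y) ([1+k]-1≡k k) ([1+k]-2≡k-1 k) ⟩
      α k j (+ k) - α k j (+ k - + 1)
        ≡⟨ cong₂ _-_ (α-diagonal k j) (α-below-diagonal k j 0) ⟩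
      + (k C j) - + 0
        ≡⟨ ℤP.+-identityʳ (+ (k C j)) ⟩
      + (k C j) ∎

  module PeriodicPart (F : ℕ → Polyℤxy) (i₀ j₀ : ℕ) (P : ℕ → ℤ) (Pᴾ : PolynomialOn Positive P)
                      (g : ℕ → ℤ) (ρ₀ : ℕ) (1≤ρ₀ : 1 ≤ ρ₀)
                      (F≡P+g : ∀ q → Positive q → F q i₀ j₀ ≡ P q + g q)
                      (g-periodic : ∀ q t → Positive q → g (q ℕ.+ t ℕ.* ρ₀) ≡ g q) where

    -- p - P - g ρ′ is a polynomial vanishing at the infinitely many multiples ρ′ (1 + n ρ₀) of ρ′,
    -- where g is g ρ′ by periodicity; so it vanishes at every multiple of ρ′.
    module _ (r′ : ℕ) (p : Poly) (p≈F : ∀ t → evalT p (toℚ (+ (suc r′ ℕ.+ t ℕ.* suc r′))) ≡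
                                              toℚ (F (suc r′ ℕ.+ t ℕ.* suc r′) i₀ j₀)) where

      private
        open ℚSolver.+-*-Solver using ()
          renaming (solve to solveℚ; _:+_ to _:+ℚ_; :-_ to :-ℚ_; _:-_ to _:-ℚ_; _:=_ to _:=ℚ_)
        ρ′ = suc r′
        multiple : ℕ → ℕ
        multiple t = ρ′ ℕ.+ t ℕ.* ρ′
        c₀ = toℚ (g ρ′)
        h = p +ₚ (-ₚ poly Pᴾ +ₚ -ₚ constₚ c₀)

        evalT-h : ∀ t → evalT h (toℚ (+ multiple t)) ≡ toℚ (g (multiple t)) ℚ.- c₀
        evalT-h t = begin
          evalT h x
            ≡⟨ evalT-+ₚ p _ x ⟩
          evalT p x ℚ.+ evalT (-ₚ poly Pᴾ +ₚ -ₚ constₚ c₀) x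
            ≡⟨ cong (evalT p x ℚ.+_) (trans (evalT-+ₚ (-ₚ poly Pᴾ) (-ₚ constₚ c₀) x)
                 (cong₂ ℚ._+_ (evalT--ₚ (poly Pᴾ) x)
                              (trans (evalT--ₚ (constₚ c₀) x) (cong ℚ.-_ (evalT-constₚ c₀ x))))) ⟩
          evalT p x ℚ.+ (ℚ.- evalT (poly Pᴾ) x ℚ.+ ℚ.- c₀)
            ≡⟨ cong₂ (λ a b → a ℚ.+ (ℚ.- b ℚ.+ ℚ.- c₀))
                     (trans (p≈F t) (trans (cong toℚ (F≡P+g q (s≤s z≤n))) (toℚ-+ (P q) (g q))))
                     (agrees Pᴾ q (s≤s z≤n)) ⟩
          (toℚ (P q) ℚ.+ toℚ (g q)) ℚ.+ (ℚ.- toℚ (P q) ℚ.+ ℚ.- c₀)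
            ≡⟨ solveℚ 3 (λ a b c → (a :+ℚ b) :+ℚ (:-ℚ a :+ℚ :-ℚ c) :=ℚ b :-ℚ c)
                       refl (toℚ (P q)) (toℚ (g q)) c₀ ⟩
          toℚ (g q) ℚ.- c₀ ∎
          where
          q = multiple t
          x = toℚ (+ q)

        points : ℕ → ℚ
        points n = toℚ (+ multiple (n ℕ.* ρ₀))

        points-injective : ∀ {m n} → points m ≡ points n → m ≡ n
        points-injective {m} {n} eq = ℕP.*-cancelʳ-≡ m n ρ₀ {{ℕ.>-nonZero 1≤ρ₀}}
          (ℕP.*-cancelʳ-≡ (m ℕ.* ρ₀) (n ℕ.* ρ₀) ρ′
            (ℕP.+-cancelˡ-≡ ρ′ _ _ (ℤP.+-injective (toℚ-injective eq))))

        h-roots : ∀ n → evalT h (points n) ≡ 0ℚ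
        h-roots n = begin
          evalT h (points n)
            ≡⟨ evalT-h (n ℕ.* ρ₀) ⟩
          toℚ (g (multiple (n ℕ.* ρ₀))) ℚ.- c₀
            ≡⟨ cong (λ q → toℚ (g (ρ′ ℕ.+ q)) ℚ.- c₀) nρ₀ρ′≡nρ′ρ₀ ⟩
          toℚ (g (ρ′ ℕ.+ (n ℕ.* ρ′) ℕ.* ρ₀)) ℚ.- c₀
            ≡⟨ cong (λ z → toℚ z ℚ.- c₀) (g-periodic ρ′ (n ℕ.* ρ′) (s≤s z≤n)) ⟩
          c₀ ℚ.- c₀
            ≡⟨ ℚP.+-inverseʳ c₀ ⟩
          0ℚ ∎
          where
          nρ₀ρ′≡nρ′ρ₀ : n ℕ.* ρ₀ ℕ.* ρ′ ≡ n ℕ.* ρ′ ℕ.* ρ₀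
          nρ₀ρ′≡nρ′ρ₀ = begin
            n ℕ.* ρ₀ ℕ.* ρ′     ≡⟨ ℕP.*-assoc n ρ₀ ρ′ ⟩
            n ℕ.* (ρ₀ ℕ.* ρ′)   ≡⟨ cong (n ℕ.*_) (ℕP.*-comm ρ₀ ρ′) ⟩
            n ℕ.* (ρ′ ℕ.* ρ₀)   ≡⟨ ℕP.*-assoc n ρ′ ρ₀ ⟨
            n ℕ.* ρ′ ℕ.* ρ₀     ∎

      g-on-multiples : ∀ t → g (ρ′ ℕ.+ t ℕ.* ρ′) ≡ g ρ′
      g-on-multiples t = toℚ-injective (p-q≡0⇒p≡q _ _ (trans (sym (evalT-h t)) (h≡0 (toℚ (+ multiple t)))))
        where
        h≡0 : ∀ x → evalT h x ≡ 0ℚ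
        h≡0 = vanishing-on-injective⇒zero (length h) h ℕP.≤-refl points points-injective h-roots

    g[ρ′]≡g[ρ₀] : ∀ ρ′ → IsQuasiPolyWithPeriod F ρ′ → g ρ′ ≡ g ρ₀
    g[ρ′]≡g[ρ₀] ρ′@(suc r′) (_ , f , f≈F) = begin
      g ρ′
        ≡⟨ g-on-multiples r′ (f ρ′ i₀ j₀) (λ t → f≈F ρ′ t (s≤s z≤n) ℕP.≤-refl i₀ j₀) (ρ₀ ∸ 1) ⟨
      g (ρ′ ℕ.+ (ρ₀ ∸ 1) ℕ.* ρ′)
        ≡⟨ cong g (trans (m+[n∸1]*m≡n*m 1≤ρ₀) (ℕP.*-comm ρ₀ ρ′)) ⟩
      g (ρ₀ ℕ.+ r′ ℕ.* ρ₀)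
        ≡⟨ g-periodic ρ₀ r′ 1≤ρ₀ ⟩
      g ρ₀ ∎
      where
      m+[n∸1]*m≡n*m : ∀ {n} → 1 ≤ n → ρ′ ℕ.+ (n ∸ 1) ℕ.* ρ′ ≡ n ℕ.* ρ′
      m+[n∸1]*m≡n*m {suc n} _ = refl

  module _ (k₂ : ℕ) where

    private
      k = suc (suc k₂)
      ρ₀ = lcmUpTo (suc k₂)

    -- The terms of closedCount at weight k with i ≥ 2: the only ones that are not polynomial in q.
    gcdPart : ℕ → ℤ
    gcdPart q = ∑[ d < suc k₂ ] (α k (2 ℕ.+ d) (+ k) * fixedCount (ℕ.pred q) (2 ℕ.+ d))

    polyPart : ℤ → ℕ → ℤ
    polyPart w₀ q = β₀ k q w₀ + α₀ k w₀ + (+ q - + 1) * β k q (+ k)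
                    + (α k 0 (+ k) * fixedCount (ℕ.pred q) 0 + α k 1 (+ k) * fixedCount (ℕ.pred q) 1)

    polyPartᴾ : ∀ w₀ → PolynomialOn Positive (polyPart w₀)
    polyPartᴾ w₀ = β₀ᴾ k w₀ +ᴾ constᴾ (α₀ k w₀) +ᴾ (varᴾ -ᴾ constᴾ (+ 1)) *ᴾ βᴾ k (+ k)
                   +ᴾ (constᴾ (α k 0 (+ k)) *ᴾ fixedCount₀ᴾ +ᴾ constᴾ (α k 1 (+ k)) *ᴾ fixedCount₁ᴾ)

    closedCount≡polyPart+gcdPart : ∀ w₀ q → closedCount k w₀ (+ k) q ≡ polyPart w₀ q + gcdPart q
    closedCount≡polyPart+gcdPart w₀ q =
      solve 4 (λ X a b G → X :+ (a :+ (b :+ G)) := (X :+ (a :+ b)) :+ G) refl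
        (β₀ k q w₀ + α₀ k w₀ + (+ q - + 1) * β k q (+ k))
        (α k 0 (+ k) * fixedCount (ℕ.pred q) 0) (α k 1 (+ k) * fixedCount (ℕ.pred q) 1) (gcdPart q)

    private
      gcdTerm : ℕ → ℕ → ℤ
      gcdTerm q d = + (k C (2 ℕ.+ d)) * (+ gcd (suc d) q - + 1)

      gcdPart-term : ∀ q d → 1 ≤ q → α k (2 ℕ.+ d) (+ k) * fixedCount (ℕ.pred q) (2 ℕ.+ d) ≡ gcdTerm q d
      gcdPart-term q d 1≤q = cong₂ _*_ (α-diagonal k (2 ℕ.+ d)) (fixedCount-pred (suc d) 1≤q)

      d+1∣ρ₀ : ∀ d → d < suc k₂ → suc d ∣ ρ₀
      d+1∣ρ₀ d d<k-1 = ∣lcmUpTo (suc k₂) (suc d) (s≤s z≤n) d<k-1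

    gcdPart-periodic : ∀ q t → Positive q → gcdPart (q ℕ.+ t ℕ.* ρ₀) ≡ gcdPart q
    gcdPart-periodic q t 1≤q = ∑-cong (suc k₂) (λ d d<k-1 → begin
      α k (2 ℕ.+ d) (+ k) * fixedCount (ℕ.pred (q ℕ.+ t ℕ.* ρ₀)) (2 ℕ.+ d)
        ≡⟨ gcdPart-term (q ℕ.+ t ℕ.* ρ₀) d (ℕP.≤-trans 1≤q (ℕP.m≤m+n q _)) ⟩
      + (k C (2 ℕ.+ d)) * (+ gcd (suc d) (q ℕ.+ t ℕ.* ρ₀) - + 1)
        ≡⟨ cong (λ g → + (k C (2 ℕ.+ d)) * (+ g - + 1)) (gcd-periodic (suc d) q ρ₀ t (d+1∣ρ₀ d d<k-1)) ⟩
      gcdTerm q d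
        ≡⟨ gcdPart-term q d 1≤q ⟨
      α k (2 ℕ.+ d) (+ k) * fixedCount (ℕ.pred q) (2 ℕ.+ d) ∎)

    gcdPart≡⇒ρ₀≤ : ∀ ρ′ → Positive ρ′ → gcdPart ρ′ ≡ gcdPart ρ₀ → ρ₀ ≤ ρ′
    gcdPart≡⇒ρ₀≤ ρ′ 1≤ρ′ eq = ∣⇒≤ {{ℕ.>-nonZero 1≤ρ′}} (lcmUpTo-least (suc k₂) ρ′ divides)
      where
      1≤ρ₀ = 1≤lcmUpTo (suc k₂)
      gcd[d+1,ρ₀]≡d+1 : ∀ d → d < suc k₂ → gcd (suc d) ρ₀ ≡ suc d
      gcd[d+1,ρ₀]≡d+1 d d<k-1 = ∣-antisym (gcd[m,n]∣m (suc d) ρ₀) (gcd-greatest ∣-refl (d+1∣ρ₀ d d<k-1))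
      terms-≤ : ∀ d → d < suc k₂ → gcdTerm ρ′ d ℤ.≤ gcdTerm ρ₀ d
      terms-≤ d d<k-1 = ℤP.*-monoˡ-≤-nonNeg (+ (k C (2 ℕ.+ d))) (ℤP.+-monoˡ-≤ (- + 1) (+≤+
        (subst (gcd (suc d) ρ′ ≤_) (sym (gcd[d+1,ρ₀]≡d+1 d d<k-1)) (∣⇒≤ (gcd[m,n]∣m (suc d) ρ′)))))
      terms-≡ : ∀ d → d < suc k₂ → gcdTerm ρ′ d ≡ gcdTerm ρ₀ d
      terms-≡ = ∑-≤-≡⇒≡ (suc k₂) terms-≤ (begin
        ∑[ d < suc k₂ ] gcdTerm ρ′ d   ≡⟨ ∑-cong (suc k₂) (λ d _ → gcdPart-term ρ′ d 1≤ρ′) ⟨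
        gcdPart ρ′                     ≡⟨ eq ⟩
        gcdPart ρ₀                     ≡⟨ ∑-cong (suc k₂) (λ d _ → gcdPart-term ρ₀ d 1≤ρ₀) ⟩
        ∑[ d < suc k₂ ] gcdTerm ρ₀ d   ∎)
      divides : ∀ d → 1 ≤ d → d ≤ suc k₂ → d ∣ ρ′
      divides (suc d) _ d<k-1 = subst (_∣ ρ′) gcd[d+1,ρ′]≡d+1 (gcd[m,n]∣n (suc d) ρ′)
        where
        gcd[d+1,ρ′]≡d+1 : gcd (suc d) ρ′ ≡ suc d
        gcd[d+1,ρ′]≡d+1 =
          trans (ℤP.+-injective (x-1≡y-1⇒x≡y (ℤP.*-cancelˡ-≡ (+ (k C (2 ℕ.+ d))) _ _ (terms-≡ d d<k-1))))
                (gcd[d+1,ρ₀]≡d+1 d d<k-1)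
          where
          instance
            kC[2+d]≢0 : ℕ.NonZero (k C (2 ℕ.+ d))
            kC[2+d]≢0 = ℕ.>-nonZero (0<nCk k (2 ℕ.+ d) (s≤s (s≤s (ℕP.≤-pred d<k-1))))

    ρ₀≤period : ∀ (F : ℕ → Polyℤxy) i₀ j₀ w₀ →
                (∀ q → Positive q → F q i₀ j₀ ≡ closedCount k w₀ (+ k) q) →
                ∀ ρ′ → IsQuasiPolyWithPeriod F ρ′ → ρ₀ ≤ ρ′
    ρ₀≤period F i₀ j₀ w₀ F≡closedCount ρ′ F-period =
      gcdPart≡⇒ρ₀≤ ρ′ (proj₁ F-period) (g[ρ′]≡g[ρ₀] ρ′ F-period)
      where
      open PeriodicPart F i₀ j₀ (polyPart w₀) (polyPartᴾ w₀) gcdPart ρ₀ (1≤lcmUpTo (suc k₂))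
             (λ q 1≤q → trans (F≡closedCount q 1≤q) (closedCount≡polyPart+gcdPart w₀ q)) gcdPart-periodic

    private
      if-yes : ∀ {m n} (x : ℤ) → m ≡ n → (if does (m ℕ.≟ n) then x else + 0) ≡ x
      if-yes {m} {n} x m≡n = cong (if_then x else + 0) (dec-true (m ℕ.≟ n) m≡n)

    W-Ntil-at-k : ∀ q → Positive q → W (Ntil k) q k k ≡ closedCount k (+ k) (+ k) q
    W-Ntil-at-k (suc q′) _ = trans (W-Ntil k q′ k k) (if-yes {k ℕ.+ k} _ refl)

    W-Ztil-at-k+1 : ∀ q → Positive q → W (Ztil k) q k (suc k) ≡ closedCount k (+ suc k) (+ k) q
    W-Ztil-at-k+1 (suc q′) _ = trans (W-Ztil k q′ k (suc k))
      (trans (if-yes _ (trans (ℕP.+-suc k k) (ℕP.+-comm 1 (k ℕ.+ k))))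
             (cong (λ w → closedCount k (+ suc k) w (suc q′)) ([1+k]-1≡k k)))

    lcmUpTo≤period-Ntil : ∀ ρ′ → IsQuasiPolyWithPeriod (W (Ntil k)) ρ′ → ρ₀ ≤ ρ′
    lcmUpTo≤period-Ntil = ρ₀≤period (W (Ntil k)) k k (+ k) W-Ntil-at-k

    lcmUpTo≤period-Ztil : ∀ ρ′ → IsQuasiPolyWithPeriod (W (Ztil k)) ρ′ → ρ₀ ≤ ρ′
    lcmUpTo≤period-Ztil = ρ₀≤period (W (Ztil k)) k (suc k) (+ suc k) W-Ztil-at-k+1

open QuasiPolynomial using (W-Ntil-quasiPolynomial; W-Ztil-quasiPolynomial)
open LowerBound using (lcmUpTo≤period-Ntil; lcmUpTo≤period-Ztil)

corollary5p4 : ∀ (k : ℕ) → 2 ≤ k →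
    IsMinimumPeriod (W (Ntil k)) (lcmUpTo (k ∸ 1)) ×
    IsMinimumPeriod (W (Ztil k)) (lcmUpTo (k ∸ 1))
corollary5p4 (suc zero)      (s≤s ())
corollary5p4 k@(suc (suc k₂)) _ =
  (W-Ntil-quasiPolynomial k , lcmUpTo≤period-Ntil k₂) ,
  (W-Ztil-quasiPolynomial k , lcmUpTo≤period-Ztil k₂)
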